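{- Let $k\ge3$ and $C>0$, and let $B$ be a bipartite graph with left vertex set $I$ and right vertex set $J$ in which every left vertex has degree exactly $k$ and every right vertex has degree at most $Ck$. Then the graph $G=G(B)$ described below is explicitly constructible, has $O(k^4|I|)$ vertices and maximum vertex degree $O(k^2)$ (constants depending only on $C$), and $G$ is $k$-colourable if and only if there is a map sending each $i\in I$ to a neighbour of $i$ in $B$ injectively, i.e. if and only if the functional pigeonhole equations of $B$ are simultaneously satisfiable.
   Context: For each $i\in I$ fix an enumeration of its $k$ incident edges by $1,\dots,k$. For $c,c'\in[k]$, the gadget $H(i,i',c,c')$ consists of the vertices $i,i'$, two disjoint $k$-cliques $\ell_1,\dots,\ell_k$ and $r_1,\dots,r_k$, the edges $\{i,\ell_1\}$ and $\{i',r_1\}$, a new vertex pre-coloured $c$ adjacent to $\ell_2,\dots,\ell_{k-1}$, a new vertex pre-coloured $c'$ adjacent to $r_2,\dots,r_{k-1}$, and the edge $\{\ell_k,r_k\}$ if $c=c'$, or, if $c\ne c'$, $\ell_k$ and $r_k$ identified into one vertex. $\widehat{G}(B)$ is the union of all gadgets $H(i,i',c,c')$ over distinct $i\ne i'\in I$ and $c,c'\in[k]$ such that the $c$th edge of $i$ and the $c'$th edge of $i'$ end in the same vertex of $J$; pigeon vertices $i\in I$ are shared, all other gadget vertices are distinct. To obtain $G(B)$, take new vertices $z_1,\dots,z_M$ with $M=O(k^3|I|)$ large enough, and make every $k$ consecutive vertices $z_t,\dots,z_{t+k-1}$ a $k$-clique; then process the pre-coloured vertices of $\widehat{G}$ one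 by one, identifying a vertex pre-coloured with $c$ with the first vertex $z_t$ such that $t\equiv c \pmod k$ that has not yet been used; finally drop all pre-colourings. The functional pigeonhole equations of $B$ over variables $p_{i,j}$ ($i\in I$, $j$ a neighbour of $i$) are: $\sum_{j\in N(i)}p_{i,j}=1$ for $i\in I$; $p_{i,j}p_{i,j'}=0$ for $i\in I$, $j\neq j'\in N(i)$; $p_{i,j}p_{i',j}=0$ for $i\ne i'\in I$, $j\in N(i)\cap N(i')$, where $N(i)$ is the set of neighbours of $i$ in $B$; variables are $\{0,1\}$-valued.
   Formalization: The constant C ranges over the positive rationals. -}

module Defs where

open import Data.Nat using (ℕ; zero; suc; _+_; _*_; _∸_; _≤ᵇ_; _<ᵇ_)
open import Data.Nat.Properties using () renaming (_≟_ to _≟ℕ_)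
open import Data.Fin using (Fin; toℕ) renaming (_≟_ to _≟F_)
open import Data.Bool using (Bool; true; false; _∧_; _∨_; not; T; if_then_else_)
open import Data.Bool.Properties using (T?)
open import Data.List using (List; []; _∷_; _++_; map; concatMap; allFin; filterᵇ;
  length; lookup; take; cartesianProduct)
open import Data.Bool.ListAction using (any)
open import Data.Nat.ListAction using (sum)
open import Data.Sum using (_⊎_)
open import Data.Product using (_×_; _,_; proj₁; proj₂; Σ; ∃; ∃-syntax)
open import Data.Empty using (⊥)
open import Relation.Nullary using (does; ¬_; yes; no)
open import Relation.Binary.PropositionalEquality using (_≡_; _≢_)
open import Function using (_∘_; Injective)

_==F_ : ∀ {n} → Fin n → Fin n → Bool
a ==F b = does (a ≟F b)

_==_ : ℕ → ℕ → Bool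
a == b = does (a ≟ℕ b)

close : ℕ → ℕ → ℕ → Bool
close k a b = ((a ∸ b) <ᵇ k) ∧ ((b ∸ a) <ᵇ k)

record FinGraph : Set₁ where
  field
    V        : Set
    vertices : List V
    adj      : V → V → Bool

open FinGraph public

numVertices : FinGraph → ℕ
numVertices Γ = length (vertices Γ)

degree : (Γ : FinGraph) → V Γ → ℕ
degree Γ v = length (filterᵇ (adj Γ v) (vertices Γ))

Colourable : ℕ → FinGraph → Set
Colourable k Γ = Σ (V Γ → Fin k) λ col →
  ∀ u v → T (adj Γ u v) → col u ≢ col v

-- Bipartite graph B with left vertices I = Fin n, right vertices J = Fin m,
-- each left vertex i given with a fixed enumeration of its k incident
-- edges:  nbr i c  is the right endpoint of the c-th edge of i.

LeftRegular : ∀ {k n m} → (Fin n → Fin k → Fin m) → Set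
LeftRegular nbr = ∀ i → Injective _≡_ _≡_ (nbr i)

adjB : ∀ {k n m} → (Fin n → Fin k → Fin m) → Fin n → Fin m → Bool
adjB {k} nbr i j = any (λ c → nbr i c ==F j) (allFin k)

rightDeg : ∀ {k n m} → (Fin n → Fin k → Fin m) → Fin m → ℕ
rightDeg {n = n} nbr j = length (filterᵇ (λ i → adjB nbr i j) (allFin n))

PigeonMap : ∀ {k n m} → (Fin n → Fin k → Fin m) → Set
PigeonMap {k} {n} {m} nbr = Σ (Fin n → Fin m) λ σ →
  (∀ i → ∃[ c ] nbr i c ≡ σ i) × Injective _≡_ _≡_ σ

-- {0,1}-valued solutions of the functional pigeonhole equations of B.
-- The variable p_{i,j} is  p i j  (only its values at neighbours j of i
-- matter); arithmetic is over ℕ.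
FPHPSolution : ∀ {k n m} → (Fin n → Fin k → Fin m) → (Fin n → Fin m → ℕ) → Set
FPHPSolution {k} {n} {m} nbr p =
  (∀ i c → (p i (nbr i c) ≡ 0) ⊎ (p i (nbr i c) ≡ 1))
  × (∀ i → sum (map (λ c → p i (nbr i c)) (allFin k)) ≡ 1)
  × (∀ i c c' → nbr i c ≢ nbr i c' → p i (nbr i c) * p i (nbr i c') ≡ 0)
  × (∀ i i' → i ≢ i' → ∀ c c' → nbr i c ≡ nbr i' c' →
        p i (nbr i c) * p i' (nbr i c) ≡ 0)

FPHPSatisfiable : ∀ {k n m} → (Fin n → Fin k → Fin m) → Set
FPHPSatisfiable {k} {n} {m} nbr = Σ (Fin n → Fin m → ℕ) (FPHPSolution nbr)

module Construction (k n m : ℕ) (nbr : Fin n → Fin k → Fin m) where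

  Quad : Set
  Quad = Fin n × Fin n × Fin k × Fin k

  -- (i , i' , c , c') with i ≠ i' and the c-th edge of i and the c'-th
  -- edge of i' ending in the same right vertex (ordered pairs; fixed
  -- lexicographic order)
  isGadget : Quad → Bool
  isGadget (i , i' , c , c') = not (i ==F i') ∧ (nbr i c ==F nbr i' c')

  gadgets : List Quad
  gadgets = filterᵇ isGadget
    (cartesianProduct (allFin n)
      (cartesianProduct (allFin n) (cartesianProduct (allFin k) (allFin k))))

  NG : ℕ
  NG = length gadgets

  gad : Fin NG → Quad
  gad = lookup gadgets

  gi gi' : Fin NG → Fin n
  gi  g = proj₁ (gad g)
  gi' g = proj₁ (proj₂ (gad g))

  gc gc' : Fin NG → Fin k
  gc  g = proj₁ (proj₂ (proj₂ (gad g)))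
  gc' g = proj₂ (proj₂ (proj₂ (gad g)))

  same : Fin NG → Bool
  same g = gc g ==F gc' g

  M : ℕ
  M = 2 * k * NG

  -- pre-coloured vertices in processing order: gadget by gadget, for
  -- each gadget first the one coloured c (left), then the one coloured c'
  precolours : List (Fin k)
  precolours = concatMap (λ g → gc g ∷ gc' g ∷ []) (allFin NG)

  countCol : Fin k → List (Fin k) → ℕ
  countCol c xs = length (filterᵇ (_==F c) xs)

  -- 0-based index of the z-vertex the p-th pre-coloured vertex (colour
  -- col) is identified with: the first unused z_t with t ≡ col (mod k)
  -- (colours and z-indices are shifted by one w.r.t. the paper)
  slot : ℕ → Fin k → ℕ
  slot p col = toℕ col + k * countCol col (take p precolours)

  slotL slotR : Fin NG → ℕ
  slotL g = slot (2 * toℕ g) (gc g)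
  slotR g = slot (suc (2 * toℕ g)) (gc' g)

  data Vtx : Set where
    pig : Fin n → Vtx
    zv  : Fin M → Vtx                        -- z_{t+1}
    ℓv  : Fin NG → Fin (k ∸ 1) → Vtx         -- ℓ_{a+1}, a < k-1
    ℓk  : Fin NG → Vtx                       -- ℓ_k (= r_k if c ≠ c')
    rv  : Fin NG → Fin (k ∸ 1) → Vtx         -- r_{a+1}, a < k-1
    rk  : (g : Fin NG) → T (same g) → Vtx

  E : Vtx → Vtx → Bool
  E (pig i) (ℓv g a) = (i ==F gi g) ∧ (toℕ a == 0)
  E (pig i) (rv g a) = (i ==F gi' g) ∧ (toℕ a == 0)
  E (ℓv g a) (ℓv h b) = (g ==F h) ∧ not (a ==F b)
  E (ℓv g a) (ℓk h) = g ==F h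
  E (rv g a) (rv h b) = (g ==F h) ∧ not (a ==F b)
  E (rv g a) (rk h _) = g ==F h
  E (rv g a) (ℓk h) = (g ==F h) ∧ not (same h)
  E (ℓk g) (rk h _) = g ==F h
  E (zv t) (ℓv g a) = (toℕ t == slotL g) ∧ (1 ≤ᵇ toℕ a)
  E (zv t) (rv g a) = (toℕ t == slotR g) ∧ (1 ≤ᵇ toℕ a)
  -- z_t, z_u adjacent iff they lie in a common window of k consecutive
  -- z-vertices, i.e. t ≠ u, |t - u| < k and k ≤ M
  E (zv t) (zv u) = not (t ==F u) ∧ close k (toℕ t) (toℕ u) ∧ (k ≤ᵇ M)
  E _ _ = false

  adjG : Vtx → Vtx → Bool
  adjG u v = E u v ∨ E v u

  rkList : Fin NG → List Vtx
  rkList g with T? (same g)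
  ... | yes p = rk g p ∷ []
  ... | no _ = []

  vertexList : List Vtx
  vertexList =
    map pig (allFin n)
    ++ map zv (allFin M)
    ++ concatMap (λ g → map (ℓv g) (allFin (k ∸ 1))) (allFin NG)
    ++ map ℓk (allFin NG)
    ++ concatMap (λ g → map (rv g) (allFin (k ∸ 1))) (allFin NG)
    ++ concatMap rkList (allFin NG)

  graph : FinGraph
  graph = record { V = Vtx ; vertices = vertexList ; adj = adjG }

GB : (k n m : ℕ) → (Fin n → Fin k → Fin m) → FinGraph
GB k n m nbr = Construction.graph k n m nbr

-- Every k consecutive z-vertices form a clique, so in a proper k-colouring z_t and z_(t+k) share a
-- colour; hence the colour of z_t depends only on t mod k, and every vertex pre-coloured c is adjacent
-- to a z-vertex of one fixed colour ψ c. In a gadget H(i, i', c, c') the vertices ℓ₂, …, ℓ_(k-1) avoid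
-- ψ c and ℓ₁ avoids the colour of i; if i has colour ψ c and i' has colour ψ c', the cliques force ℓ_k
-- to have colour ψ c and r_k colour ψ c', which is impossible both when ℓ_k r_k is an edge (c = c')
-- and when ℓ_k = r_k (c ≠ c'). So sending each pigeon i to its edge with index ψ⁻¹ (colour of i) is
-- injective. Conversely, from an injective choice of edges, colour z_t by t mod k, each pigeon by the
-- index of its edge, and the two cliques of each gadget from their ends; this works because no gadget
-- has both of its colliding edges chosen. For size and degree the vertices fall into six blocks: a
-- pigeon lies in at most k · Ck gadgets on each side, and distinct pre-coloured vertices are sent to
-- distinct z-vertices.

module Submission where

open import Defs
open import Data.Nat as ℕ
  using (ℕ; zero; suc; _+_; _*_; _∸_; _^_; _≤_; _<_; z≤n; s≤s; _%_; NonZero; >-nonZero; _≤ᵇ_; _<ᵇ_)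
import Data.Nat.Properties as ℕ
open import Data.Nat.DivMod using (m≡m%n+[m/n]*n; [m+kn]%n≡m%n; m<n⇒m%n≡m; m%n<n)
open import Data.Nat.ListAction using () renaming (sum to listSum)
open import Data.Nat.Tactic.RingSolver using (solve-∀)
open import Data.Fin using (Fin; zero; suc; toℕ; fromℕ<; punchIn; punchOut; _≟_)
open import Data.Fin.Patterns using (0F; 1F; 2F; 3F; 4F; 5F)
open import Data.Fin.Properties
  using (toℕ-injective; toℕ<n; toℕ-fromℕ<; suc-injective; any?; injective⇒≤;
         punchOut-injective; punchIn-injective; punchInᵢ≢i; punchIn-punchOut)
import Data.Vec.Functional as Vector
open import Data.Bool using (Bool; true; false; T; _∧_; _∨_; not)
open import Data.Bool.Properties using (T?; T-∧; T-∨; T-irrelevant)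
open import Data.Unit using (tt)
open import Data.Empty using (⊥; ⊥-elim)
open import Data.Product using (_×_; _,_; proj₁; proj₂; ∃-syntax)
open import Data.Sum using (_⊎_; inj₁; inj₂; [_,_])
open import Function using (_∘_; id; Injective)
open import Function.Bundles using (Equivalence; _⇔_; mk⇔)
open import Function.Construct.Composition using (_⇔-∘_)
open import Relation.Nullary using (¬_; Dec; yes; no; does)
open import Relation.Binary using (Tri; tri<; tri≈; tri>)
open import Relation.Binary.PropositionalEquality
  using (_≡_; _≢_; refl; sym; trans; cong; cong₂; subst; subst₂; module ≡-Reasoning)
open import Algebra.Properties.CommutativeMonoid.Sum ℕ.+-0-commutativeMonoid
  using (sum; sum-syntax; sum-cong-≗; sum-replicate-zero; ∑-comm)
open import Algebra.Properties.Semiring.Sum ℕ.+-*-semiring using (*-distribʳ-sum)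
open import Data.List
  using (List; []; _∷_; _++_; map; concat; concatMap; allFin; tabulate; filterᵇ; length; lookup; take; drop;
         cartesianProduct)
open import Data.List.Properties
  using (filter-++; length-++; length-filter; length-take; length-map; length-tabulate; map-tabulate; ++-identityʳ)
open import Data.List.Membership.Propositional using (_∈_)
open import Data.List.Membership.Propositional.Properties
  using (∈-allFin; ∈-concatMap⁺; ∈-concatMap⁻; ∈-map⁺; ∈-map⁻; ∈-lookup; ∈-filter⁺; ∈-filter⁻; ∈-cartesianProduct⁺)
import Data.List.Relation.Unary.All as All
import Data.List.Relation.Unary.All.Properties as All
open import Data.List.Relation.Unary.AllPairs using ([]; _∷_)
import Data.List.Relation.Unary.AllPairs.Properties as AllPairs
open import Data.List.Relation.Unary.Any using (here)
import Data.List.Relation.Unary.Any as Any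
open import Data.List.Relation.Unary.Any.Properties using (lookup-index; any⁺)
open import Data.List.Relation.Unary.Unique.Propositional using (Unique)
open import Data.List.Relation.Unary.Unique.Propositional.Properties using (map⁺; allFin⁺; concat⁺)

module _ {a} {A : Set a} where

  does-sound : (d : Dec A) → T (does d) → A
  does-sound (yes x) _ = x

  does-complete : (d : Dec A) → A → T (does d)
  does-complete (yes _) _ = tt
  does-complete (no ¬x) x = ¬x x

  not-does-sound : (d : Dec A) → T (not (does d)) → ¬ A
  not-does-sound (no ¬x) _ = ¬x

  not-does-complete : (d : Dec A) → ¬ A → T (not (does d))
  not-does-complete (yes x) ¬x = ¬x x
  not-does-complete (no _) _ = tt

module _ {x y : Bool} where

  T-∧⁺ : T x → T y → T (x ∧ y)
  T-∧⁺ tx ty = Equivalence.from T-∧ (tx , ty)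

  T-∧⁻ : T (x ∧ y) → T x × T y
  T-∧⁻ = Equivalence.to T-∧

  T-∨⁻ : T (x ∨ y) → T x ⊎ T y
  T-∨⁻ = Equivalence.to T-∨

  T-∨⁺ˡ : T x → T (x ∨ y)
  T-∨⁺ˡ tx = Equivalence.from T-∨ (inj₁ tx)

T-∨-falseʳ : ∀ {x} → T (x ∨ false) → T x
T-∨-falseʳ {true} _ = tt

-- T (a ==F b) does not determine a and b for unification, so many uses name them explicitly.
module _ {n} {a b : Fin n} where

  ≢⇒!=F : a ≢ b → T (not (a ==F b))
  ≢⇒!=F = not-does-complete (a ≟ b)

  !=F⇒≢ : T (not (a ==F b)) → a ≢ b
  !=F⇒≢ = not-does-sound (a ≟ b)

  ==F⇒≡ : T (a ==F b) → a ≡ b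
  ==F⇒≡ = does-sound (a ≟ b)

  ≡⇒==F : a ≡ b → T (a ==F b)
  ≡⇒==F = does-complete (a ≟ b)

==F-refl : ∀ {n} (a : Fin n) → T (a ==F a)
==F-refl a = ≡⇒==F {a = a} refl

module _ {a b : ℕ} where

  ==⇒≡ : T (a == b) → a ≡ b
  ==⇒≡ = does-sound (a ℕ.≟ b)

  ≡⇒== : a ≡ b → T (a == b)
  ≡⇒== = does-complete (a ℕ.≟ b)

module _ {a} {A : Set a} {n} {f : A → Fin (suc n)} {y : Fin (suc n)} where

  punchOut-missing-injective : (miss : ∀ x → f x ≢ y) → Injective _≡_ _≡_ f →
    Injective _≡_ _≡_ (λ x → punchOut (miss x ∘ sym))
  punchOut-missing-injective miss inj eq = inj (punchOut-injective (miss _ ∘ sym) (miss _ ∘ sym) eq)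

injective⇒surjective : ∀ {n} {f : Fin n → Fin n} → Injective _≡_ _≡_ f → ∀ y → ∃[ x ] f x ≡ y
injective⇒surjective {suc n} {f} inj y with any? (λ x → f x ≟ y)
... | yes hit = hit
... | no miss = ⊥-elim (ℕ.1+n≰n (injective⇒≤ (punchOut-missing-injective (λ x e → miss (x , e)) inj)))

module _ {a} {A : Set a} {n} {f : Fin n → A} where

  distinct⇒injective : (∀ {i j} → i ≢ j → f i ≢ f j) → Injective _≡_ _≡_ f
  distinct⇒injective distinct {i} {j} eq with i ≟ j
  ... | yes i≡j = i≡j
  ... | no i≢j = ⊥-elim (distinct i≢j eq)

  <-distinct⇒injective : (∀ {i j} → toℕ i < toℕ j → f i ≢ f j) → Injective _≡_ _≡_ f
  <-distinct⇒injective distinct {i} {j} eq with ℕ.<-cmp (toℕ i) (toℕ j)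
  ... | tri< i<j _ _ = ⊥-elim (distinct i<j eq)
  ... | tri≈ _ i≡j _ = toℕ-injective i≡j
  ... | tri> _ _ j<i = ⊥-elim (distinct j<i (sym eq))

cons-injective : ∀ {a} {A : Set a} {n} {f : Fin n → A} {y} → Injective _≡_ _≡_ f → (∀ i → f i ≢ y) →
  Injective _≡_ _≡_ (y Vector.∷ f)
cons-injective inj miss {zero} {zero} _ = refl
cons-injective inj miss {zero} {suc j} e = ⊥-elim (miss j (sym e))
cons-injective inj miss {suc i} {zero} e = ⊥-elim (miss i e)
cons-injective inj miss {suc i} {suc j} e = cong suc (inj e)

injective-missing-unique : ∀ {n} {f : Fin n → Fin (suc n)} → Injective _≡_ _≡_ f →
  ∀ {x y} → (∀ a → f a ≢ x) → (∀ a → f a ≢ y) → x ≡ y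
injective-missing-unique inj {x} {y} miss-x miss-y with x ≟ y
... | yes x≡y = x≡y
... | no x≢y with injective⇒surjective (cons-injective inj miss-y) x
...   | zero , y≡x = ⊥-elim (x≢y (sym y≡x))
...   | suc a , fa≡x = ⊥-elim (miss-x a fa≡x)

punchIn₂ : ∀ {n} (p q : Fin (suc (suc n))) → p ≢ q → Fin n → Fin (suc (suc n))
punchIn₂ p q p≢q = punchIn p ∘ punchIn (punchOut p≢q)

module _ {n} {p q : Fin (suc (suc n))} (p≢q : p ≢ q) where

  punchIn₂-injective : Injective _≡_ _≡_ (punchIn₂ p q p≢q)
  punchIn₂-injective = punchIn-injective _ _ _ ∘ punchIn-injective p _ _

  punchIn₂≢p : ∀ a → punchIn₂ p q p≢q a ≢ p
  punchIn₂≢p a = punchInᵢ≢i p _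

  punchIn₂≢q : ∀ a → punchIn₂ p q p≢q a ≢ q
  punchIn₂≢q a e = punchInᵢ≢i (punchOut p≢q) a
    (punchIn-injective p _ _ (trans e (sym (punchIn-punchOut p≢q))))

fresh : ∀ {n} (u v : Fin (suc (suc (suc n)))) → ∃[ w ] w ≢ u × w ≢ v
fresh u v with u ≟ v
... | yes refl = punchIn u zero , punchInᵢ≢i u zero , punchInᵢ≢i u zero
... | no u≢v = punchIn₂ u v u≢v zero , punchIn₂≢p u≢v zero , punchIn₂≢q u≢v zero

⟦_⟧ : Bool → ℕ
⟦ true ⟧ = 1
⟦ false ⟧ = 0

⟦⟧≤1 : ∀ b → ⟦ b ⟧ ≤ 1
⟦⟧≤1 true = ℕ.≤-refl
⟦⟧≤1 false = z≤n

⟦⟧-mono : ∀ {a b} → (T a → T b) → ⟦ a ⟧ ≤ ⟦ b ⟧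
⟦⟧-mono {true} {true} _ = ℕ.≤-refl
⟦⟧-mono {true} {false} a⇒b = ⊥-elim (a⇒b tt)
⟦⟧-mono {false} _ = z≤n

⟦⟧-true : ∀ {a} → T a → ⟦ a ⟧ ≡ 1
⟦⟧-true {true} _ = refl

⟦⟧-false : ∀ {a} → ¬ T a → ⟦ a ⟧ ≡ 0
⟦⟧-false {true} ¬a = ⊥-elim (¬a tt)
⟦⟧-false {false} _ = refl

∑-mono-≤ : ∀ {n} {f g : Fin n → ℕ} → (∀ i → f i ≤ g i) → sum f ≤ sum g
∑-mono-≤ {zero} _ = z≤n
∑-mono-≤ {suc n} f≤g = ℕ.+-mono-≤ (f≤g zero) (∑-mono-≤ (f≤g ∘ suc))

∑-const : ∀ n b → ∑[ i < n ] b ≡ n * b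
∑-const zero b = refl
∑-const (suc n) b = cong (b +_) (∑-const n b)

∑-≤-* : ∀ {n} {f : Fin n → ℕ} {b} → (∀ i → f i ≤ b) → sum f ≤ n * b
∑-≤-* {n} {b = b} f≤b = ℕ.≤-trans (∑-mono-≤ f≤b) (ℕ.≤-reflexive (∑-const n b))

∑-zero : ∀ {n} {f : Fin n → ℕ} → (∀ i → f i ≡ 0) → sum f ≡ 0
∑-zero {n} f≡0 = trans (sum-cong-≗ f≡0) (sum-replicate-zero n)

∑-single : ∀ {n} {f : Fin n → ℕ} i₀ → (∀ i → i ≢ i₀ → f i ≡ 0) → sum f ≡ f i₀
∑-single {suc n} {f} zero vanish =
  trans (cong (f zero +_) (∑-zero (λ i → vanish (suc i) λ ()))) (ℕ.+-identityʳ _)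
∑-single {suc n} {f} (suc i₀) vanish =
  cong₂ _+_ (vanish zero λ ()) (∑-single i₀ (λ i i≢i₀ → vanish (suc i) (i≢i₀ ∘ suc-injective)))

∑-⟦⟧-≤1 : ∀ {n} (p : Fin n → Bool) → (∀ i j → T (p i) → T (p j) → i ≡ j) → ∑[ i < n ] ⟦ p i ⟧ ≤ 1
∑-⟦⟧-≤1 {n} p unique with any? (λ i → T? (p i))
... | no none = ℕ.≤-trans (ℕ.≤-reflexive (∑-zero (λ i → ⟦⟧-false (λ pi → none (i , pi))))) z≤n
... | yes (i₀ , pi₀) = ℕ.≤-trans (ℕ.≤-reflexive (∑-single i₀ vanish)) (⟦⟧≤1 (p i₀))
  where
  vanish : ∀ i → i ≢ i₀ → ⟦ p i ⟧ ≡ 0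
  vanish i i≢i₀ = ⟦⟧-false (λ pi → i≢i₀ (unique i i₀ pi pi₀))

∑-select : ∀ {n} {f : Fin n → ℕ} (s : Fin n → Bool) w →
  (∀ i → f i ≤ ⟦ s i ⟧ * w) → sum f ≤ (∑[ i < n ] ⟦ s i ⟧) * w
∑-select s w f≤ = ℕ.≤-trans (∑-mono-≤ f≤) (ℕ.≤-reflexive (sym (*-distribʳ-sum w (λ i → ⟦ s i ⟧))))

∑-⟦⟧-≤1-at : ∀ {n} (p : Fin n → Bool) i₀ → (∀ i → T (p i) → i ≡ i₀) → ∑[ i < n ] ⟦ p i ⟧ ≤ 1
∑-⟦⟧-≤1-at p i₀ only = ∑-⟦⟧-≤1 p (λ i j pi pj → trans (only i pi) (sym (only j pj)))

∑-⟦⟧-≤-guard : ∀ {n} (p : Fin n → Bool) {b} → (∀ i → T (p i) → T b) → ∑[ i < n ] ⟦ p i ⟧ ≤ ⟦ b ⟧ * n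
∑-⟦⟧-≤-guard {n} p {true} _ = ℕ.≤-trans (∑-≤-* (λ i → ⟦⟧≤1 (p i))) (ℕ.≤-reflexive (ℕ.*-comm n 1))
∑-⟦⟧-≤-guard p {false} guard = ℕ.≤-reflexive (∑-zero λ i → ⟦⟧-false (guard i))

∑-⟦⟧-≤-guard₁ : ∀ {n} (p : Fin n → Bool) {b} → (∀ i → T (p i) → T b) → (∀ i j → T (p i) → T (p j) → i ≡ j) →
  ∑[ i < n ] ⟦ p i ⟧ ≤ ⟦ b ⟧ * 1
∑-⟦⟧-≤-guard₁ p {true} _ unique = ∑-⟦⟧-≤1 p unique
∑-⟦⟧-≤-guard₁ p {false} guard _ = ∑-⟦⟧-≤-guard p guard

∑-pick : ∀ {n} (i₀ : Fin n) (f : Fin n → ℕ) → ∑[ i < n ] (⟦ i ==F i₀ ⟧ * f i) ≡ f i₀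
∑-pick i₀ f = trans (∑-single i₀ vanish) (trans (cong (_* f i₀) (⟦⟧-true (==F-refl i₀))) (ℕ.*-identityˡ (f i₀)))
  where
  vanish : ∀ i → i ≢ i₀ → ⟦ i ==F i₀ ⟧ * f i ≡ 0
  vanish i i≢i₀ = cong (_* f i) (⟦⟧-false (i≢i₀ ∘ ==F⇒≡ {a = i} {i₀}))

count : ∀ {a} {A : Set a} → (A → Bool) → List A → ℕ
count p xs = length (filterᵇ p xs)

count-∷ : ∀ {a} {A : Set a} (p : A → Bool) x xs → count p (x ∷ xs) ≡ ⟦ p x ⟧ + count p xs
count-∷ p x xs with p x
... | true = refl
... | false = refl

⟦∧⟧ : ∀ a b → ⟦ a ∧ b ⟧ ≡ ⟦ a ⟧ * ⟦ b ⟧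
⟦∧⟧ true b = sym (ℕ.+-identityʳ ⟦ b ⟧)
⟦∧⟧ false b = refl

module _ {a} {A : Set a} (p : A → Bool) where

  count-++ : ∀ xs ys → count p (xs ++ ys) ≡ count p xs + count p ys
  count-++ xs ys = trans (cong length (filter-++ (T? ∘ p) xs ys)) (length-++ (filterᵇ p xs))

  count-map : ∀ {b} {B : Set b} (f : B → A) xs → count p (map f xs) ≡ count (p ∘ f) xs
  count-map f [] = refl
  count-map f (x ∷ xs) = trans (count-∷ p (f x) _)
    (trans (cong (⟦ p (f x) ⟧ +_) (count-map f xs)) (sym (count-∷ (p ∘ f) x xs)))

  count-≤-length : ∀ xs → count p xs ≤ length xs
  count-≤-length = length-filter (T? ∘ p)

  count-tabulate : ∀ {n} (f : Fin n → A) → count p (tabulate f) ≡ ∑[ i < n ] ⟦ p (f i) ⟧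
  count-tabulate {zero} f = refl
  count-tabulate {suc n} f = trans (count-∷ p (f zero) _) (cong (⟦ p (f zero) ⟧ +_) (count-tabulate (f ∘ suc)))

  count-map-allFin : ∀ {n} (f : Fin n → A) → count p (map f (allFin n)) ≡ ∑[ i < n ] ⟦ p (f i) ⟧
  count-map-allFin f = trans (cong (count p) (map-tabulate id f)) (count-tabulate f)

  count-concat-tabulate : ∀ {n} (f : Fin n → List A) → count p (concat (tabulate f)) ≡ ∑[ i < n ] count p (f i)
  count-concat-tabulate {zero} f = refl
  count-concat-tabulate {suc n} f =
    trans (count-++ (f zero) _) (cong (count p (f zero) +_) (count-concat-tabulate (f ∘ suc)))

  count-concatMap-allFin : ∀ {n} (f : Fin n → List A) → count p (concatMap f (allFin n)) ≡ ∑[ i < n ] count p (f i)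
  count-concatMap-allFin f = trans (cong (count p ∘ concat) (map-tabulate id f)) (count-concat-tabulate f)

  count-lookup : ∀ xs → count p xs ≡ ∑[ i < length xs ] ⟦ p (lookup xs i) ⟧
  count-lookup [] = refl
  count-lookup (x ∷ xs) = trans (count-∷ p x xs) (cong (⟦ p x ⟧ +_) (count-lookup xs))

  count-filter : ∀ q xs → count p (filterᵇ q xs) ≡ count (λ x → q x ∧ p x) xs
  count-filter q [] = refl
  count-filter q (x ∷ xs) with q x | count-∷ (λ y → q y ∧ p y) x xs
  ... | true | eq = trans (count-∷ p x _) (trans (cong (⟦ p x ⟧ +_) (count-filter q xs)) (sym eq))
  ... | false | eq = trans (count-filter q xs) (sym eq)

  count-∧ʳ : ∀ b xs → count (λ x → p x ∧ b) xs ≡ ⟦ b ⟧ * count p xs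
  count-∧ʳ b [] = sym (ℕ.*-zeroʳ ⟦ b ⟧)
  count-∧ʳ b (x ∷ xs) = begin
    count (λ x → p x ∧ b) (x ∷ xs)          ≡⟨ count-∷ (λ x → p x ∧ b) x xs ⟩
    ⟦ p x ∧ b ⟧ + count (λ x → p x ∧ b) xs  ≡⟨ cong₂ _+_ (trans (⟦∧⟧ (p x) b) (ℕ.*-comm ⟦ p x ⟧ ⟦ b ⟧)) (count-∧ʳ b xs) ⟩
    ⟦ b ⟧ * ⟦ p x ⟧ + ⟦ b ⟧ * count p xs    ≡⟨ ℕ.*-distribˡ-+ ⟦ b ⟧ ⟦ p x ⟧ _ ⟨
    ⟦ b ⟧ * (⟦ p x ⟧ + count p xs)          ≡⟨ cong (⟦ b ⟧ *_) (count-∷ p x xs) ⟨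
    ⟦ b ⟧ * count p (x ∷ xs)                ∎
    where open ≡-Reasoning

count-true : ∀ {a} {A : Set a} (xs : List A) → count (λ _ → true) xs ≡ length xs
count-true [] = refl
count-true (x ∷ xs) = cong suc (count-true xs)

count-cartesianProduct-allFin : ∀ {a} {B : Set a} {n} (p : Fin n × B → Bool) ys →
  count p (cartesianProduct (allFin n) ys) ≡ ∑[ i < n ] count (λ y → p (i , y)) ys
count-cartesianProduct-allFin p ys = go id
  where
  go : ∀ {m} (g : Fin m → _) → count p (cartesianProduct (tabulate g) ys) ≡ ∑[ i < m ] count (λ y → p (g i , y)) ys
  go {zero} g = refl
  go {suc m} g = trans (count-++ p (map (g zero ,_) ys) _)
    (cong₂ _+_ (count-map p (g zero ,_) ys) (go (g ∘ suc)))

-- ⟦ lo ≤ u < lo + w ⟧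
inInterval : ℕ → ℕ → ℕ → Bool
inInterval zero zero u = false
inInterval zero (suc w) zero = true
inInterval zero (suc w) (suc u) = inInterval zero w u
inInterval (suc lo) w zero = false
inInterval (suc lo) w (suc u) = inInterval lo w u

∑-inInterval-≤ : ∀ M lo w → ∑[ u < M ] ⟦ inInterval lo w (toℕ u) ⟧ ≤ w
∑-inInterval-≤ zero lo w = z≤n
∑-inInterval-≤ (suc M) zero zero = ∑-inInterval-≤ M zero zero
∑-inInterval-≤ (suc M) zero (suc w) = s≤s (∑-inInterval-≤ M zero w)
∑-inInterval-≤ (suc M) (suc lo) w = ∑-inInterval-≤ M lo w

inInterval-complete : ∀ lo w u → lo ≤ u → u < lo + w → T (inInterval lo w u)
inInterval-complete zero (suc w) zero _ _ = tt
inInterval-complete zero (suc w) (suc u) _ (s≤s u<w) = inInterval-complete zero w u z≤n u<w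
inInterval-complete (suc lo) w (suc u) (s≤s lo≤u) (s≤s u<lo+w) = inInterval-complete lo w u lo≤u u<lo+w

close⇒inInterval : ∀ K t u → T (close K t u) → T (inInterval (t ∸ K) (2 * K) u)
close⇒inInterval K t u close-tu = inInterval-complete (t ∸ K) (2 * K) u lower upper
  where
  open ℕ.≤-Reasoning
  t∸u<K : t ∸ u < K
  t∸u<K = ℕ.<ᵇ⇒< _ _ (proj₁ (T-∧⁻ {t ∸ u <ᵇ K} close-tu))
  u∸t<K : u ∸ t < K
  u∸t<K = ℕ.<ᵇ⇒< _ _ (proj₂ (T-∧⁻ {t ∸ u <ᵇ K} close-tu))
  lower : t ∸ K ≤ u
  lower = ℕ.m≤n+o⇒m∸n≤o t K (begin
    t             ≤⟨ ℕ.m≤n+m∸n t u ⟩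
    u + (t ∸ u)   ≤⟨ ℕ.+-monoʳ-≤ u (ℕ.<⇒≤ t∸u<K) ⟩
    u + K         ≡⟨ ℕ.+-comm u K ⟩
    K + u         ∎)
  upper : u < t ∸ K + 2 * K
  upper = begin-strict
    u                   ≤⟨ ℕ.m≤n+m∸n u t ⟩
    t + (u ∸ t)         <⟨ ℕ.+-monoʳ-< t u∸t<K ⟩
    t + K               ≤⟨ ℕ.+-monoˡ-≤ K (ℕ.m≤n+m∸n t K) ⟩
    K + (t ∸ K) + K     ≡⟨ rearrange K (t ∸ K) ⟩
    t ∸ K + 2 * K       ∎
    where
    rearrange : ∀ K x → K + x + K ≡ x + 2 * K
    rearrange = solve-∀

module _ (K : ℕ) .{{_ : NonZero K}} where

  [r+K*q]%K≡r : ∀ {r} q → r < K → (r + K * q) % K ≡ r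
  [r+K*q]%K≡r {r} q r<K = begin
    (r + K * q) % K ≡⟨ cong (λ x → (r + x) % K) (ℕ.*-comm K q) ⟩
    (r + q * K) % K ≡⟨ [m+kn]%n≡m%n r q K ⟩
    r % K           ≡⟨ m<n⇒m%n≡m r<K ⟩
    r               ∎
    where open ≡-Reasoning

  -- t = r + (t / K) K and u = r + (u / K) K with t < u force u / K > t / K, hence u ≥ t + K.
  close⇒%-distinct : ∀ {t u} → t < u → u < t + K → t % K ≢ u % K
  close⇒%-distinct {t} {u} t<u u<t+K t%≡u% = ℕ.<⇒≱ u<t+K t+K≤u
    where
    open ℕ.≤-Reasoning
    r = t % K
    qt<qu : t ℕ./ K < u ℕ./ K
    qt<qu = ℕ.*-cancelʳ-< K (t ℕ./ K) (u ℕ./ K) (ℕ.+-cancelˡ-< r _ _ (begin-strict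
      r + t ℕ./ K * K       ≡⟨ m≡m%n+[m/n]*n t K ⟨
      t                     <⟨ t<u ⟩
      u                     ≡⟨ m≡m%n+[m/n]*n u K ⟩
      u % K + u ℕ./ K * K   ≡⟨ cong (_+ u ℕ./ K * K) t%≡u% ⟨
      r + u ℕ./ K * K       ∎))
    t+K≤u : t + K ≤ u
    t+K≤u = begin
      t + K                   ≡⟨ cong (_+ K) (m≡m%n+[m/n]*n t K) ⟩
      r + t ℕ./ K * K + K     ≡⟨ ℕ.+-assoc r _ K ⟩
      r + (t ℕ./ K * K + K)   ≡⟨ cong (r +_) (ℕ.+-comm (t ℕ./ K * K) K) ⟩
      r + suc (t ℕ./ K) * K   ≤⟨ ℕ.+-monoʳ-≤ r (ℕ.*-monoˡ-≤ K qt<qu) ⟩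
      r + u ℕ./ K * K         ≡⟨ cong (_+ u ℕ./ K * K) t%≡u% ⟩
      u % K + u ℕ./ K * K     ≡⟨ m≡m%n+[m/n]*n u K ⟨
      u                       ∎

module _ {a} {A : Set a} (p : A → Bool) where

  count-take-mono : ∀ xs {i j} → i ≤ j → count p (take i xs) ≤ count p (take j xs)
  count-take-mono xs {zero} _ = z≤n
  count-take-mono [] {suc i} {suc j} _ = z≤n
  count-take-mono (x ∷ xs) {suc i} {suc j} (s≤s i≤j) = begin
    count p (x ∷ take i xs)       ≡⟨ count-∷ p x _ ⟩
    ⟦ p x ⟧ + count p (take i xs) ≤⟨ ℕ.+-monoʳ-≤ ⟦ p x ⟧ (count-take-mono xs i≤j) ⟩
    ⟦ p x ⟧ + count p (take j xs) ≡⟨ count-∷ p x _ ⟨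
    count p (x ∷ take j xs)       ∎
    where open ℕ.≤-Reasoning

  count-take-step : ∀ xs i {y ys} → drop i xs ≡ y ∷ ys → T (p y) →
    count p (take i xs) < count p (take (suc i) xs)
  count-take-step (x ∷ xs) zero refl py rewrite count-∷ p x [] | ⟦⟧-true py = s≤s z≤n
  count-take-step (x ∷ xs) (suc i) eq py rewrite count-∷ p x (take i xs) | count-∷ p x (take (suc i) xs) =
    ℕ.+-monoʳ-< ⟦ p x ⟧ (count-take-step xs i eq py)

  count-take-increasing : ∀ xs {i j y ys} → drop i xs ≡ y ∷ ys → T (p y) → i < j →
    count p (take i xs) < count p (take j xs)
  count-take-increasing xs {i} eq py i<j = ℕ.<-≤-trans (count-take-step xs i eq py) (count-take-mono xs i<j)

-- With xs = precolours this is Construction.slot: the z-vertex taking the pre-coloured vertex at position i.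
occurrenceCode : ∀ {K} → List (Fin K) → ℕ → Fin K → ℕ
occurrenceCode {K} xs i x = toℕ x + K * count (_==F x) (take i xs)

module _ {K} (xs : List (Fin K)) where

  occurrenceCode-% : ∀ i x → .{{_ : NonZero K}} → occurrenceCode xs i x % K ≡ toℕ x
  occurrenceCode-% i x = [r+K*q]%K≡r K _ (toℕ<n x)

  occurrenceCode-< : ∀ i x → occurrenceCode xs i x < K * suc i
  occurrenceCode-< i x = begin-strict
    toℕ x + K * count (_==F x) (take i xs) <⟨ ℕ.+-monoˡ-< _ (toℕ<n x) ⟩
    K + K * count (_==F x) (take i xs)     ≤⟨ ℕ.+-monoʳ-≤ K (ℕ.*-monoʳ-≤ K count≤i) ⟩
    K + K * i                              ≡⟨ ℕ.*-suc K i ⟨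
    K * suc i                              ∎
    where
    open ℕ.≤-Reasoning
    count≤i : count (_==F x) (take i xs) ≤ i
    count≤i = ℕ.≤-trans (count-≤-length _ (take i xs)) (ℕ.≤-trans (ℕ.≤-reflexive (length-take i xs)) (ℕ.m⊓n≤m i _))

  occurrenceCode-injective : ∀ {i j x y ys zs} → drop i xs ≡ x ∷ ys → drop j xs ≡ y ∷ zs →
    occurrenceCode xs i x ≡ occurrenceCode xs j y → i ≡ j
  occurrenceCode-injective {i} {j} {x} {y} {zs = zs} at-i at-j eq = compare (ℕ.<-cmp i j)
    where
    instance
      K≢0 : NonZero K
      K≢0 = >-nonZero (ℕ.≤-<-trans z≤n (toℕ<n x))
    x≡y : x ≡ y
    x≡y = toℕ-injective (begin
      toℕ x                       ≡⟨ occurrenceCode-% i x ⟨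
      occurrenceCode xs i x % K   ≡⟨ cong (_% K) eq ⟩
      occurrenceCode xs j y % K   ≡⟨ occurrenceCode-% j y ⟩
      toℕ y                       ∎)
      where open ≡-Reasoning
    same-rank : count (_==F x) (take i xs) ≡ count (_==F x) (take j xs)
    same-rank = ℕ.*-cancelˡ-≡ _ _ K (ℕ.+-cancelˡ-≡ (toℕ x) _ _
      (subst (λ v → occurrenceCode xs i x ≡ occurrenceCode xs j v) (sym x≡y) eq))
    at-j′ : drop j xs ≡ x ∷ zs
    at-j′ = subst (λ v → drop j xs ≡ v ∷ zs) (sym x≡y) at-j
    compare : Tri (i < j) (i ≡ j) (j < i) → i ≡ j
    compare (tri< i<j _ _) = ⊥-elim (ℕ.<-irrefl same-rank (count-take-increasing (_==F x) xs at-i (==F-refl x) i<j))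
    compare (tri≈ _ i≡j _) = i≡j
    compare (tri> _ _ j<i) = ⊥-elim (ℕ.<-irrefl (sym same-rank) (count-take-increasing (_==F x) xs at-j′ (==F-refl x) j<i))

module _ {a} {A : Set a} {n} {f : Fin n → List A} where

  ∈-concatMap-allFin⁺ : ∀ i {x} → x ∈ f i → x ∈ concatMap f (allFin n)
  ∈-concatMap-allFin⁺ i x∈fi = ∈-concatMap⁺ f (Any.map (λ { refl → x∈fi }) (∈-allFin i))

  ∈-concatMap-allFin⁻ : ∀ {x} → x ∈ concatMap f (allFin n) → ∃[ i ] x ∈ f i
  ∈-concatMap-allFin⁻ x∈ = Any.satisfied (∈-concatMap⁻ f {xs = allFin n} x∈)

  concatMap-allFin⁺ : (∀ i → Unique (f i)) → (∀ {i j x} → x ∈ f i → x ∈ f j → i ≡ j) →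
    Unique (concatMap f (allFin n))
  concatMap-allFin⁺ unique disjoint = subst (Unique ∘ concat) (sym (map-tabulate id f))
    (concat⁺ (All.tabulate⁺ unique) (AllPairs.tabulate⁺ (λ i≢j (x∈fi , x∈fj) → i≢j (disjoint x∈fi x∈fj))))

drop-∷ : ∀ {a} {A : Set a} i (xs : List A) {x ys} → drop i xs ≡ x ∷ ys → drop (suc i) xs ≡ ys
drop-∷ zero (x ∷ xs) refl = refl
drop-∷ (suc i) (x ∷ xs) eq = drop-∷ i xs eq

drop-pairs : ∀ {a} {A : Set a} {N} (f f′ : Fin N → A) i →
  ∃[ ys ] drop (2 * toℕ i) (concatMap (λ j → f j ∷ f′ j ∷ []) (allFin N)) ≡ f i ∷ f′ i ∷ ys
drop-pairs f f′ = go id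
  where
  pairs : ∀ {M} → (Fin M → _) → List _
  pairs g = concatMap (λ j → f j ∷ f′ j ∷ []) (tabulate g)
  go : ∀ {M} (g : Fin M → _) i → ∃[ ys ] drop (2 * toℕ i) (pairs g) ≡ f (g i) ∷ f′ (g i) ∷ ys
  go g zero = _ , refl
  go g (suc i) = subst (λ d → ∃[ ys ] drop d (pairs g) ≡ f (g (suc i)) ∷ f′ (g (suc i)) ∷ ys)
    (sym (ℕ.*-suc 2 (toℕ i))) (go (g ∘ suc) i)

length-map-allFin : ∀ {a} {A : Set a} {n} (f : Fin n → A) → length (map f (allFin n)) ≡ n
length-map-allFin {n = n} f = trans (length-map f (allFin n)) (length-tabulate id)

length-concatMap-allFin : ∀ {a} {A : Set a} {n} (f : Fin n → List A) →
  length (concatMap f (allFin n)) ≡ ∑[ i < n ] length (f i)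
length-concatMap-allFin {n = n} f = trans (sym (count-true (concatMap f (allFin n))))
  (trans (count-concatMap-allFin _ f) (sum-cong-≗ (count-true ∘ f)))

map-allFin⁺ : ∀ {a} {A : Set a} {n} {f : Fin n → A} → Injective _≡_ _≡_ f → Unique (map f (allFin n))
map-allFin⁺ {n = n} inj = map⁺ inj (allFin⁺ n)

module _ {k n m} {nbr : Fin n → Fin k → Fin m} where

  choice⇒pigeonMap : (ch : Fin n → Fin k) → Injective _≡_ _≡_ (λ i → nbr i (ch i)) → PigeonMap nbr
  choice⇒pigeonMap ch inj = (λ i → nbr i (ch i)) , (λ i → ch i , refl) , inj

  pigeonMap⇒choice : PigeonMap nbr → ∃[ ch ] Injective _≡_ _≡_ (λ i → nbr i (ch i))
  pigeonMap⇒choice (σ , edge , inj) =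
    (λ i → proj₁ (edge i)) , λ eq → inj (trans (sym (proj₂ (edge _))) (trans eq (proj₂ (edge _))))

listSum-allFin : ∀ {n} (f : Fin n → ℕ) → listSum (map f (allFin n)) ≡ sum f
listSum-allFin f = trans (cong listSum (map-tabulate id f)) (go f)
  where
  go : ∀ {n} (f : Fin n → ℕ) → listSum (tabulate f) ≡ sum f
  go {zero} f = refl
  go {suc n} f = cong (f zero +_) (go (f ∘ suc))

⟦⟧-01 : ∀ b → ⟦ b ⟧ ≡ 0 ⊎ ⟦ b ⟧ ≡ 1
⟦⟧-01 true = inj₂ refl
⟦⟧-01 false = inj₁ refl

⟦⟧*⟦⟧≡0 : ∀ {a b} → (T a → T b → ⊥) → ⟦ a ⟧ * ⟦ b ⟧ ≡ 0
⟦⟧*⟦⟧≡0 {true} {true} exclusive = ⊥-elim (exclusive tt tt)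
⟦⟧*⟦⟧≡0 {true} {false} _ = refl
⟦⟧*⟦⟧≡0 {false} _ = refl

module _ {k n m} {nbr : Fin n → Fin k → Fin m} where

  pigeonMap⇒fphp : LeftRegular nbr → PigeonMap nbr → FPHPSatisfiable nbr
  pigeonMap⇒fphp regular (σ , edge , σ-injective) = p , (λ i c → ⟦⟧-01 _) , one-edge , exclusive , no-collision
    where
    p : Fin n → Fin m → ℕ
    p i j = ⟦ j ==F σ i ⟧
    one-edge : ∀ i → listSum (map (λ c → p i (nbr i c)) (allFin k)) ≡ 1
    one-edge i with edge i
    ... | c₀ , nbr-c₀ =
      trans (listSum-allFin (λ c → p i (nbr i c))) (trans (∑-single c₀ vanish) (⟦⟧-true (≡⇒==F nbr-c₀)))
      where
      vanish : ∀ c → c ≢ c₀ → p i (nbr i c) ≡ 0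
      vanish c c≢c₀ = ⟦⟧-false (λ hit → c≢c₀ (regular i (trans (==F⇒≡ {a = nbr i c} {σ i} hit) (sym nbr-c₀))))
    exclusive : ∀ i c c' → nbr i c ≢ nbr i c' → p i (nbr i c) * p i (nbr i c') ≡ 0
    exclusive i c c' distinct = ⟦⟧*⟦⟧≡0 {nbr i c ==F σ i} {nbr i c' ==F σ i} λ hit hit' →
      distinct (trans (==F⇒≡ {a = nbr i c} {σ i} hit) (sym (==F⇒≡ {a = nbr i c'} {σ i} hit')))
    no-collision : ∀ i i' → i ≢ i' → ∀ c c' → nbr i c ≡ nbr i' c' → p i (nbr i c) * p i' (nbr i c) ≡ 0
    no-collision i i' i≢i' c c' _ = ⟦⟧*⟦⟧≡0 {nbr i c ==F σ i} {nbr i c ==F σ i'} λ hit hit' →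
      i≢i' (σ-injective (trans (sym (==F⇒≡ {a = nbr i c} {σ i} hit)) (==F⇒≡ {a = nbr i c} {σ i'} hit')))

  fphp⇒pigeonMap : FPHPSatisfiable nbr → PigeonMap nbr
  fphp⇒pigeonMap (p , zero-one , one-edge , _ , no-collision) = choice⇒pigeonMap ch ch-injective
    where
    chosen : ∀ i → ∃[ c ] p i (nbr i c) ≡ 1
    chosen i with any? (λ c → p i (nbr i c) ℕ.≟ 1)
    ... | yes found = found
    ... | no none =
      ⊥-elim (ℕ.0≢1+n (trans (sym (∑-zero vanish)) (trans (sym (listSum-allFin (λ c → p i (nbr i c)))) (one-edge i))))
      where
      vanish : ∀ c → p i (nbr i c) ≡ 0
      vanish c = [ id , (λ is-1 → ⊥-elim (none (c , is-1))) ] (zero-one i c)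
    ch : Fin n → Fin k
    ch i = proj₁ (chosen i)
    ch-injective : Injective _≡_ _≡_ (λ i → nbr i (ch i))
    ch-injective {i} {i'} collide with i ≟ i'
    ... | yes i≡i' = i≡i'
    ... | no i≢i' = ⊥-elim (ℕ.0≢1+n (begin
      0                                         ≡⟨ no-collision i i' i≢i' (ch i) (ch i') collide ⟨
      p i (nbr i (ch i)) * p i' (nbr i (ch i))  ≡⟨ cong₂ _*_ (proj₂ (chosen i)) (trans (cong (p i') collide) (proj₂ (chosen i'))) ⟩
      1                                         ∎))
      where open ≡-Reasoning

  pigeonMap⇔fphp : LeftRegular nbr → PigeonMap nbr ⇔ FPHPSatisfiable nbr
  pigeonMap⇔fphp regular = mk⇔ (pigeonMap⇒fphp regular) fphp⇒pigeonMap

module _ {n} {p q : Fin (suc (suc n))} (p≢q : p ≢ q) where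

  cliqueColours : Fin (suc n) → Fin (suc (suc n))
  cliqueColours = p Vector.∷ punchIn₂ p q p≢q

  cliqueColours-injective : Injective _≡_ _≡_ cliqueColours
  cliqueColours-injective = cons-injective (punchIn₂-injective p≢q) (punchIn₂≢p p≢q)

  cliqueColours≢q : ∀ a → cliqueColours a ≢ q
  cliqueColours≢q zero = p≢q
  cliqueColours≢q (suc a) = punchIn₂≢q p≢q a

  cliqueColours-suc≢ : ∀ {c} → c ≡ p ⊎ c ≡ q → ∀ a → cliqueColours (suc a) ≢ c
  cliqueColours-suc≢ (inj₁ refl) a = punchIn₂≢p p≢q a
  cliqueColours-suc≢ (inj₂ refl) a = punchIn₂≢q p≢q a

-- Colours of the ends ℓ₁, ℓₖ, r₁, rₖ of a gadget with pre-colours c, c' whose pigeons have colours a, b.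
record EndColours {N} (c c' a b : Fin N) : Set where
  field
    ℓ₁ ℓₖ r₁ rₖ : Fin N
    ℓ₁≢a : ℓ₁ ≢ a
    r₁≢b : r₁ ≢ b
    ℓ₁≢ℓₖ : ℓ₁ ≢ ℓₖ
    r₁≢rₖ : r₁ ≢ rₖ
    c∈ℓ : c ≡ ℓ₁ ⊎ c ≡ ℓₖ
    c'∈r : c' ≡ r₁ ⊎ c' ≡ rₖ
    ends-distinct : c ≡ c' → ℓₖ ≢ rₖ
    ends-equal : c ≢ c' → ℓₖ ≡ rₖ

mirror : ∀ {N} {c c' a b : Fin N} → EndColours c' c b a → EndColours c c' a b
mirror e = record
  { ℓ₁ = r₁ ; ℓₖ = rₖ ; r₁ = ℓ₁ ; rₖ = ℓₖ
  ; ℓ₁≢a = r₁≢b ; r₁≢b = ℓ₁≢a ; ℓ₁≢ℓₖ = r₁≢rₖ ; r₁≢rₖ = ℓ₁≢ℓₖ ; c∈ℓ = c'∈r ; c'∈r = c∈ℓ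
  ; ends-distinct = λ c≡c' → ends-distinct (sym c≡c') ∘ sym
  ; ends-equal = λ c≢c' → sym (ends-equal (c≢c' ∘ sym))
  }
  where open EndColours e

endColours-left : ∀ {n} {c c' a b : Fin (suc (suc (suc n)))} → a ≢ c → EndColours c c' a b
endColours-left {c = c} {c'} {a} {b} a≢c with fresh c' b | c ≟ c'
... | w , w≢c' , w≢b | yes refl = record
  { ℓ₁ = c ; ℓₖ = w ; r₁ = w ; rₖ = c
  ; ℓ₁≢a = a≢c ∘ sym ; r₁≢b = w≢b ; ℓ₁≢ℓₖ = w≢c' ∘ sym ; r₁≢rₖ = w≢c' ; c∈ℓ = inj₁ refl ; c'∈r = inj₂ refl
  ; ends-distinct = λ _ → w≢c' ; ends-equal = λ c≢c → ⊥-elim (c≢c refl)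
  }
... | w , w≢c' , w≢b | no c≢c' = record
  { ℓ₁ = c ; ℓₖ = c' ; r₁ = w ; rₖ = c'
  ; ℓ₁≢a = a≢c ∘ sym ; r₁≢b = w≢b ; ℓ₁≢ℓₖ = c≢c' ; r₁≢rₖ = w≢c' ; c∈ℓ = inj₁ refl ; c'∈r = inj₂ refl
  ; ends-distinct = λ c≡c' → ⊥-elim (c≢c' c≡c') ; ends-equal = λ _ → refl
  }

endColours : ∀ {n} {c c' a b : Fin (suc (suc (suc n)))} → ¬ (a ≡ c × b ≡ c') → EndColours c c' a b
endColours {c = c} {a = a} not-both with a ≟ c
... | no a≢c = endColours-left a≢c
... | yes a≡c = mirror (endColours-left (λ b≡c' → not-both (a≡c , b≡c')))

module Graph (k₀ n m : ℕ) (nbr : Fin n → Fin (suc (suc (suc k₀))) → Fin m) where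

  K : ℕ
  K = suc (suc (suc k₀))

  open Construction K n m nbr public

  quads : List Quad
  quads = cartesianProduct (allFin n) (cartesianProduct (allFin n) (cartesianProduct (allFin K) (allFin K)))

  gadget-valid : ∀ g → gi g ≢ gi' g × nbr (gi g) (gc g) ≡ nbr (gi' g) (gc' g)
  gadget-valid g with T-∧⁻ (proj₂ (∈-filter⁻ (T? ∘ isGadget) {xs = quads} (∈-lookup g)))
  ... | distinct , collide = !=F⇒≢ distinct , ==F⇒≡ collide

  gadget-complete : ∀ {i i' c c'} → i ≢ i' → nbr i c ≡ nbr i' c' → ∃[ g ] gad g ≡ (i , i' , c , c')
  gadget-complete {i} {i'} {c} {c'} i≢i' collide = Any.index q∈ , sym (lookup-index q∈)
    where
    q∈ : (i , i' , c , c') ∈ gadgets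
    q∈ = ∈-filter⁺ (T? ∘ isGadget)
      (∈-cartesianProduct⁺ (∈-allFin i)
        (∈-cartesianProduct⁺ (∈-allFin i') (∈-cartesianProduct⁺ (∈-allFin c) (∈-allFin c'))))
      (T-∧⁺ (≢⇒!=F i≢i') (≡⇒==F collide))

  precolour-left : ∀ g → ∃[ ys ] drop (2 * toℕ g) precolours ≡ gc g ∷ ys
  precolour-left g with drop-pairs gc gc' g
  ... | ys , eq = gc' g ∷ ys , eq

  precolour-right : ∀ g → ∃[ ys ] drop (suc (2 * toℕ g)) precolours ≡ gc' g ∷ ys
  precolour-right g with drop-pairs gc gc' g
  ... | ys , eq = ys , drop-∷ (2 * toℕ g) precolours eq

  slot-< : ∀ g i c → i ≤ suc (2 * toℕ g) → slot i c < M
  slot-< g i c i≤ = begin-strict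
    slot i c                    <⟨ occurrenceCode-< precolours i c ⟩
    K * suc i                   ≤⟨ ℕ.*-monoʳ-≤ K (s≤s i≤) ⟩
    K * suc (suc (2 * toℕ g))   ≡⟨ cong (K *_) (ℕ.*-suc 2 (toℕ g)) ⟨
    K * (2 * suc (toℕ g))       ≡⟨ ℕ.*-assoc K 2 (suc (toℕ g)) ⟨
    K * 2 * suc (toℕ g)         ≡⟨ cong (_* suc (toℕ g)) (ℕ.*-comm K 2) ⟩
    2 * K * suc (toℕ g)         ≤⟨ ℕ.*-monoʳ-≤ (2 * K) {suc (toℕ g)} {NG} (toℕ<n g) ⟩
    2 * K * NG                  ∎
    where open ℕ.≤-Reasoning

  slotL-< : ∀ g → slotL g < M
  slotL-< g = slot-< g (2 * toℕ g) (gc g) (ℕ.n≤1+n _)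

  slotR-< : ∀ g → slotR g < M
  slotR-< g = slot-< g (suc (2 * toℕ g)) (gc' g) ℕ.≤-refl

  slot-% : ∀ i c → slot i c % K ≡ toℕ c
  slot-% i c = occurrenceCode-% precolours i c

  slotL-injective : ∀ {g h} → slotL g ≡ slotL h → g ≡ h
  slotL-injective {g} {h} eq = toℕ-injective (ℕ.*-cancelˡ-≡ (toℕ g) (toℕ h) 2
    (occurrenceCode-injective precolours (proj₂ (precolour-left g)) (proj₂ (precolour-left h)) eq))

  slotR-injective : ∀ {g h} → slotR g ≡ slotR h → g ≡ h
  slotR-injective {g} {h} eq = toℕ-injective (ℕ.*-cancelˡ-≡ (toℕ g) (toℕ h) 2 (ℕ.suc-injective
    (occurrenceCode-injective precolours (proj₂ (precolour-right g)) (proj₂ (precolour-right h)) eq)))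

  gadget⇒K≤M : Fin NG → K ≤ M
  gadget⇒K≤M g = ℕ.≤-trans (ℕ.m≤m+n K (K + 0)) (ℕ.m≤m*n (2 * K) NG {{>-nonZero (ℕ.≤-<-trans z≤n (toℕ<n g))}})

  z : (t : ℕ) → .(t < M) → Vtx
  z t t<M = zv (fromℕ< t<M)

  z-edge : K ≤ M → ∀ {t u} .(t<M : t < M) .(u<M : u < M) → t < u → u < t + K → T (adjG (z t t<M) (z u u<M))
  z-edge K≤M {t} {u} t<M u<M t<u u<t+K = T-∨⁺ˡ (T-∧⁺ (≢⇒!=F t≢u) (T-∧⁺ (T-∧⁺ t∸u<K u∸t<K) (ℕ.≤⇒≤ᵇ K≤M)))
    where
    t≢u : fromℕ< t<M ≢ fromℕ< u<M
    t≢u eq = ℕ.<⇒≢ t<u (trans (sym (toℕ-fromℕ< t<M)) (trans (cong toℕ eq) (toℕ-fromℕ< u<M)))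
    t∸u<K : T ((toℕ (fromℕ< t<M) ∸ toℕ (fromℕ< u<M)) <ᵇ K)
    t∸u<K rewrite toℕ-fromℕ< t<M | toℕ-fromℕ< u<M | ℕ.m≤n⇒m∸n≡0 (ℕ.<⇒≤ t<u) = tt
    u∸t<K : T ((toℕ (fromℕ< u<M) ∸ toℕ (fromℕ< t<M)) <ᵇ K)
    u∸t<K rewrite toℕ-fromℕ< t<M | toℕ-fromℕ< u<M = ℕ.<⇒<ᵇ (ℕ.m<n+o⇒m∸n<o u t u<t+K)

  z-cong : ∀ {t u} .{t<M : t < M} .{u<M : u < M} → t ≡ u → z t t<M ≡ z u u<M
  z-cong refl = refl

  Hits : (Fin n → Fin K) → Fin NG → Set
  Hits ch g = ch (gi g) ≡ gc g × ch (gi' g) ≡ gc' g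

  injective⇒avoids : ∀ {ch} → Injective _≡_ _≡_ (λ i → nbr i (ch i)) → ∀ g → ¬ Hits ch g
  injective⇒avoids {ch} inj g (left , right) = proj₁ (gadget-valid g) (inj (begin
    nbr (gi g) (ch (gi g))     ≡⟨ cong (nbr (gi g)) left ⟩
    nbr (gi g) (gc g)          ≡⟨ proj₂ (gadget-valid g) ⟩
    nbr (gi' g) (gc' g)        ≡⟨ cong (nbr (gi' g)) right ⟨
    nbr (gi' g) (ch (gi' g))   ∎))
    where open ≡-Reasoning

  avoids⇒injective : ∀ {ch} → (∀ g → ¬ Hits ch g) → Injective _≡_ _≡_ (λ i → nbr i (ch i))
  avoids⇒injective {ch} avoids {i} {i'} collide with i ≟ i'
  ... | yes i≡i' = i≡i'
  ... | no i≢i' with gadget-complete i≢i' collide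
  ...   | g , g≡ = ⊥-elim (avoids g (hit (cong proj₁ g≡) (cong (proj₁ ∘ proj₂ ∘ proj₂) g≡) ,
                                     hit (cong (proj₁ ∘ proj₂) g≡) (cong (proj₂ ∘ proj₂ ∘ proj₂) g≡)))
    where
    hit : ∀ {j j' c} → j ≡ j' → c ≡ ch j' → ch j ≡ c
    hit refl refl = refl

  module ProperColouring (col : Vtx → Fin K) (proper : ∀ u v → T (adjG u v) → col u ≢ col v) where

    edge : ∀ u v → T (E u v) → col u ≢ col v
    edge u v = proper u v ∘ T-∨⁺ˡ

    module _ (K≤M : K ≤ M) where

      z-distinct : ∀ {t u} (t<M : t < M) (u<M : u < M) → t < u → u < t + K → col (z t t<M) ≢ col (z u u<M)
      z-distinct t<M u<M t<u u<t+K = proper _ _ (z-edge K≤M t<M u<M t<u u<t+K)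

      -- The K - 1 vertices strictly between z_t and z_(t+K) form a clique adjacent to both.
      z-periodic : ∀ {t} (t+K<M : t + K < M) → col (z t _) ≡ col (z (t + K) t+K<M)
      z-periodic {t} t+K<M = injective-missing-unique between-injective avoids-first avoids-last
        where
        t<M : t < M
        t<M = ℕ.≤-<-trans (ℕ.m≤m+n t K) t+K<M
        inside : ∀ (a : Fin (suc (suc k₀))) → t + suc (toℕ a) < t + K
        inside a = ℕ.+-monoʳ-< t (s≤s (toℕ<n a))
        bound : ∀ a → t + suc (toℕ a) < M
        bound a = ℕ.<-trans (inside a) t+K<M
        between : Fin (suc (suc k₀)) → Fin K
        between a = col (z (t + suc (toℕ a)) (bound a))
        shifted : ∀ a → t + K < t + suc (toℕ a) + K
        shifted a = ℕ.+-monoˡ-< K (ℕ.m<m+n t (s≤s z≤n))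
        between-injective : Injective _≡_ _≡_ between
        between-injective = <-distinct⇒injective λ {a} {b} a<b →
          z-distinct (bound a) (bound b) (ℕ.+-monoʳ-< t (s≤s a<b))
            (ℕ.<-trans (inside b) (ℕ.+-monoˡ-< K (ℕ.m<m+n t (s≤s z≤n))))
        avoids-first : ∀ a → between a ≢ col (z t t<M)
        avoids-first a eq = z-distinct t<M (bound a) (ℕ.m<m+n t (s≤s z≤n)) (inside a) (sym eq)
        avoids-last : ∀ a → between a ≢ col (z (t + K) t+K<M)
        avoids-last a = z-distinct (bound a) t+K<M (inside a) (shifted a)

      c<M : (c : Fin K) → toℕ c < M
      c<M c = ℕ.<-≤-trans (toℕ<n c) K≤M

      ψ : Fin K → Fin K
      ψ c = col (z (toℕ c) (c<M c))

      ψ-injective : Injective _≡_ _≡_ ψ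
      ψ-injective = <-distinct⇒injective λ {c} {d} c<d →
        z-distinct (c<M c) (c<M d) c<d (ℕ.<-≤-trans (toℕ<n d) (ℕ.m≤n+m K (toℕ c)))

      z-colour : ∀ c q (h : toℕ c + K * q < M) → col (z (toℕ c + K * q) h) ≡ ψ c
      z-colour c zero h = cong col (z-cong (trans (cong (toℕ c +_) (ℕ.*-zeroʳ K)) (ℕ.+-identityʳ (toℕ c))))
      z-colour c (suc q) h = begin
        col (z (toℕ c + K * suc q) h)    ≡⟨ cong col (z-cong step) ⟩
        col (z (toℕ c + K * q + K) h′)   ≡⟨ z-periodic h′ ⟨
        col (z (toℕ c + K * q) _)        ≡⟨ z-colour c q (ℕ.≤-<-trans (ℕ.m≤m+n _ K) h′) ⟩
        ψ c                              ∎
        where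
        open ≡-Reasoning
        step : toℕ c + K * suc q ≡ toℕ c + K * q + K
        step = trans (cong (toℕ c +_) (trans (ℕ.*-suc K q) (ℕ.+-comm K (K * q)))) (sym (ℕ.+-assoc (toℕ c) (K * q) K))
        h′ : toℕ c + K * q + K < M
        h′ = subst (_< M) step h

      module _ {g : Fin NG} (left : col (pig (gi g)) ≡ ψ (gc g)) (right : col (pig (gi' g)) ≡ ψ (gc' g)) where

        ℓ-avoids : ∀ a → col (ℓv g a) ≢ ψ (gc g)
        ℓ-avoids zero eq = edge (pig (gi g)) (ℓv g zero) (T-∧⁺ (==F-refl (gi g)) tt) (trans left (sym eq))
        ℓ-avoids (suc a) eq = edge (z (slotL g) (slotL-< g)) (ℓv g (suc a)) (T-∧⁺ (≡⇒== (toℕ-fromℕ< (slotL-< g))) tt)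
          (trans (z-colour (gc g) (countCol (gc g) (take (2 * toℕ g) precolours)) (slotL-< g)) (sym eq))

        r-avoids : ∀ a → col (rv g a) ≢ ψ (gc' g)
        r-avoids zero eq = edge (pig (gi' g)) (rv g zero) (T-∧⁺ (==F-refl (gi' g)) tt) (trans right (sym eq))
        r-avoids (suc a) eq = edge (z (slotR g) (slotR-< g)) (rv g (suc a)) (T-∧⁺ (≡⇒== (toℕ-fromℕ< (slotR-< g))) tt)
          (trans (z-colour (gc' g) (countCol (gc' g) (take (suc (2 * toℕ g)) precolours)) (slotR-< g)) (sym eq))

        ℓ-injective : Injective _≡_ _≡_ (col ∘ ℓv g)
        ℓ-injective = distinct⇒injective λ a≢b → edge (ℓv g _) (ℓv g _) (T-∧⁺ (==F-refl g) (≢⇒!=F a≢b))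

        r-injective : Injective _≡_ _≡_ (col ∘ rv g)
        r-injective = distinct⇒injective λ a≢b → edge (rv g _) (rv g _) (T-∧⁺ (==F-refl g) (≢⇒!=F a≢b))

        ℓk-colour : col (ℓk g) ≡ ψ (gc g)
        ℓk-colour = injective-missing-unique ℓ-injective (λ a → edge (ℓv g a) (ℓk g) (==F-refl g)) ℓ-avoids

        right-end-colour : ∀ {v} → (∀ a → T (E (rv g a) v)) → col v ≡ ψ (gc' g)
        right-end-colour adjacent = injective-missing-unique r-injective (λ a → edge (rv g a) _ (adjacent a)) r-avoids

        hit-impossible : ⊥
        hit-impossible with gc g ≟ gc' g
        ... | yes c≡c' = edge (ℓk g) (rk g (≡⇒==F c≡c')) (==F-refl g)
          (trans ℓk-colour (trans (cong ψ c≡c') (sym (right-end-colour (λ a → ==F-refl g)))))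
        ... | no c≢c' = c≢c' (ψ-injective (trans (sym ℓk-colour)
          (right-end-colour (λ a → T-∧⁺ (==F-refl g) (≢⇒!=F c≢c')))))

      ψ-surjective : ∀ y → ∃[ c ] ψ c ≡ y
      ψ-surjective = injective⇒surjective ψ-injective

      choice : Fin n → Fin K
      choice i = proj₁ (ψ-surjective (col (pig i)))

      choice-avoids : ∀ g → ¬ Hits choice g
      choice-avoids g (left , right) = hit-impossible (pigeon-colour left) (pigeon-colour right)
        where
        pigeon-colour : ∀ {i c} → choice i ≡ c → col (pig i) ≡ ψ c
        pigeon-colour {i} refl = sym (proj₂ (ψ-surjective (col (pig i))))

    -- Without room for a window of K z-vertices there are no gadgets at all.
    avoidingChoice : ∃[ ch ] (∀ g → ¬ Hits ch g)
    avoidingChoice with K ℕ.≤? M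
    ... | yes K≤M = choice K≤M , choice-avoids K≤M
    ... | no K≰M = (λ _ → zero) , λ g _ → K≰M (gadget⇒K≤M g)

  module AvoidingChoice (ch : Fin n → Fin K) (avoids : ∀ g → ¬ Hits ch g) where

    ends : ∀ g → EndColours (gc g) (gc' g) (ch (gi g)) (ch (gi' g))
    ends g = endColours (avoids g)

    module End g = EndColours (ends g)

    ℓColour rColour : Fin NG → Fin (suc (suc k₀)) → Fin K
    ℓColour g = cliqueColours (End.ℓ₁≢ℓₖ g)
    rColour g = cliqueColours (End.r₁≢rₖ g)

    zColour : ℕ → Fin K
    zColour t = fromℕ< (m%n<n t K)

    col : Vtx → Fin K
    col (pig i) = ch i
    col (zv t) = zColour (toℕ t)
    col (ℓv g a) = ℓColour g a
    col (ℓk g) = End.ℓₖ g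
    col (rv g a) = rColour g a
    col (rk g _) = End.rₖ g

    zColour-slot : ∀ {t i c} → t ≡ slot i c → zColour t ≡ c
    zColour-slot {t} {i} {c} t≡slot = toℕ-injective (begin
      toℕ (zColour t) ≡⟨ toℕ-fromℕ< (m%n<n t K) ⟩
      t % K            ≡⟨ cong (_% K) t≡slot ⟩
      slot i c % K     ≡⟨ slot-% i c ⟩
      toℕ c            ∎)
      where open ≡-Reasoning

    zColour-close : ∀ {t u} → t < u → T ((u ∸ t) <ᵇ K) → zColour t ≢ zColour u
    zColour-close {t} {u} t<u u∸t<K eq = close⇒%-distinct K t<u u<t+K (begin
      t % K            ≡⟨ toℕ-fromℕ< (m%n<n t K) ⟨
      toℕ (zColour t)  ≡⟨ cong toℕ eq ⟩
      toℕ (zColour u)  ≡⟨ toℕ-fromℕ< (m%n<n u K) ⟩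
      u % K            ∎)
      where
      open ≡-Reasoning
      u<t+K : u < t + K
      u<t+K = ℕ.≤-<-trans (ℕ.m≤n+m∸n u t) (ℕ.+-monoʳ-< t (ℕ.<ᵇ⇒< _ _ u∸t<K))

    pig-ℓ : ∀ i g a → T (E (pig i) (ℓv g a)) → ch i ≢ ℓColour g a
    pig-ℓ i g zero e with refl ← ==F⇒≡ {a = i} {gi g} (proj₁ (T-∧⁻ {i ==F gi g} e)) = End.ℓ₁≢a g ∘ sym
    pig-ℓ i g (suc a) e = ⊥-elim (proj₂ (T-∧⁻ {i ==F gi g} e))

    pig-r : ∀ i g a → T (E (pig i) (rv g a)) → ch i ≢ rColour g a
    pig-r i g zero e with refl ← ==F⇒≡ {a = i} {gi' g} (proj₁ (T-∧⁻ {i ==F gi' g} e)) = End.r₁≢b g ∘ sym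
    pig-r i g (suc a) e = ⊥-elim (proj₂ (T-∧⁻ {i ==F gi' g} e))

    z-ℓ : ∀ t g a → T (E (zv t) (ℓv g a)) → zColour (toℕ t) ≢ ℓColour g a
    z-ℓ t g zero e = ⊥-elim (proj₂ (T-∧⁻ {toℕ t == slotL g} e))
    z-ℓ t g (suc a) e eq = cliqueColours-suc≢ (End.ℓ₁≢ℓₖ g) (End.c∈ℓ g) a
      (trans (sym eq) (zColour-slot {i = 2 * toℕ g} (==⇒≡ {toℕ t} {slotL g} (proj₁ (T-∧⁻ {toℕ t == slotL g} e)))))

    z-r : ∀ t g a → T (E (zv t) (rv g a)) → zColour (toℕ t) ≢ rColour g a
    z-r t g zero e = ⊥-elim (proj₂ (T-∧⁻ {toℕ t == slotR g} e))
    z-r t g (suc a) e eq = cliqueColours-suc≢ (End.r₁≢rₖ g) (End.c'∈r g) a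
      (trans (sym eq) (zColour-slot {i = suc (2 * toℕ g)} (==⇒≡ {toℕ t} {slotR g} (proj₁ (T-∧⁻ {toℕ t == slotR g} e)))))

    z-z : ∀ t u → T (E (zv t) (zv u)) → zColour (toℕ t) ≢ zColour (toℕ u)
    z-z t u e with T-∧⁻ {not (t ==F u)} e
    ... | t≠u , rest with T-∧⁻ {toℕ t ∸ toℕ u <ᵇ K} (proj₁ (T-∧⁻ {close K (toℕ t) (toℕ u)} rest))
    ...   | t∸u<K , u∸t<K with ℕ.<-cmp (toℕ t) (toℕ u)
    ...     | tri< t<u _ _ = zColour-close t<u u∸t<K
    ...     | tri≈ _ t≡u _ = ⊥-elim (!=F⇒≢ {a = t} {u} t≠u (toℕ-injective t≡u))
    ...     | tri> _ _ u<t = zColour-close u<t t∸u<K ∘ sym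

    module _ {f : Fin NG → Fin (suc (suc k₀)) → Fin K} (f-injective : ∀ g → Injective _≡_ _≡_ (f g)) where

      same-clique : ∀ g a h b → T ((g ==F h) ∧ not (a ==F b)) → f g a ≢ f h b
      same-clique g a h b e with refl ← ==F⇒≡ {a = g} {h} (proj₁ (T-∧⁻ {g ==F h} e)) =
        !=F⇒≢ {a = a} {b} (proj₂ (T-∧⁻ {g ==F h} e)) ∘ f-injective g

    proper : ∀ u v → T (E u v) → col u ≢ col v
    proper (pig i) (ℓv g a) e = pig-ℓ i g a e
    proper (pig i) (rv g a) e = pig-r i g a e
    proper (ℓv g a) (ℓv h b) e = same-clique (λ g → cliqueColours-injective (End.ℓ₁≢ℓₖ g)) g a h b e
    proper (rv g a) (rv h b) e = same-clique (λ g → cliqueColours-injective (End.r₁≢rₖ g)) g a h b e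
    proper (ℓv g a) (ℓk h) e with refl ← ==F⇒≡ {a = g} {h} e = cliqueColours≢q (End.ℓ₁≢ℓₖ g) a
    proper (rv g a) (rk h _) e with refl ← ==F⇒≡ {a = g} {h} e = cliqueColours≢q (End.r₁≢rₖ g) a
    proper (rv g a) (ℓk h) e with refl ← ==F⇒≡ {a = g} {h} (proj₁ (T-∧⁻ {g ==F h} e)) =
      subst (rColour g a ≢_) (sym (End.ends-equal g (!=F⇒≢ {a = gc g} {gc' g} (proj₂ (T-∧⁻ {g ==F g} e)))))
        (cliqueColours≢q (End.r₁≢rₖ g) a)
    proper (ℓk g) (rk h same) e with refl ← ==F⇒≡ {a = g} {h} e = End.ends-distinct g (==F⇒≡ {a = gc g} {gc' g} same)
    proper (zv t) (ℓv g a) e = z-ℓ t g a e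
    proper (zv t) (rv g a) e = z-r t g a e
    proper (zv t) (zv u) e = z-z t u e
    proper (pig _) (pig _) ()
    proper (pig _) (zv _) ()
    proper (pig _) (ℓk _) ()
    proper (pig _) (rk _ _) ()
    proper (zv _) (pig _) ()
    proper (zv _) (ℓk _) ()
    proper (zv _) (rk _ _) ()
    proper (ℓv _ _) (pig _) ()
    proper (ℓv _ _) (zv _) ()
    proper (ℓv _ _) (rv _ _) ()
    proper (ℓv _ _) (rk _ _) ()
    proper (ℓk _) (pig _) ()
    proper (ℓk _) (zv _) ()
    proper (ℓk _) (ℓv _ _) ()
    proper (ℓk _) (ℓk _) ()
    proper (ℓk _) (rv _ _) ()
    proper (rv _ _) (pig _) ()
    proper (rv _ _) (zv _) ()
    proper (rv _ _) (ℓv _ _) ()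
    proper (rk _ _) _ ()

    colouring : Colourable K graph
    colouring = col , λ u v adj → [ proper u v , (λ e → proper v u e ∘ sym) ] (T-∨⁻ adj)

  colourable⇔pigeonMap : Colourable K graph ⇔ PigeonMap nbr
  colourable⇔pigeonMap = mk⇔ colouring⇒pigeonMap pigeonMap⇒colouring
    where
    colouring⇒pigeonMap : Colourable K graph → PigeonMap nbr
    colouring⇒pigeonMap (col , proper) with ProperColouring.avoidingChoice col proper
    ... | ch , avoids = choice⇒pigeonMap ch (avoids⇒injective avoids)
    pigeonMap⇒colouring : PigeonMap nbr → Colourable K graph
    pigeonMap⇒colouring σ with pigeonMap⇒choice σ
    ... | ch , injective = AvoidingChoice.colouring ch (injective⇒avoids injective)

  block : Fin 6 → List Vtx
  block 0F = map pig (allFin n)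
  block 1F = map zv (allFin M)
  block 2F = concatMap (λ g → map (ℓv g) (allFin (K ∸ 1))) (allFin NG)
  block 3F = map ℓk (allFin NG)
  block 4F = concatMap (λ g → map (rv g) (allFin (K ∸ 1))) (allFin NG)
  block 5F = concatMap rkList (allFin NG)

  blockOf : Vtx → Fin 6
  blockOf (pig _) = 0F
  blockOf (zv _) = 1F
  blockOf (ℓv _ _) = 2F
  blockOf (ℓk _) = 3F
  blockOf (rv _ _) = 4F
  blockOf (rk _ _) = 5F

  vertexList-blocks : vertexList ≡ concatMap block (allFin 6)
  vertexList-blocks =
    cong (λ xs → block 0F ++ block 1F ++ block 2F ++ block 3F ++ block 4F ++ xs) (sym (++-identityʳ (block 5F)))

  rk∈rkList : ∀ g s → rk g s ∈ rkList g
  rk∈rkList g s with T? (same g)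
  ... | yes s′ = here (cong (rk g) (T-irrelevant s s′))
  ... | no ¬s = ⊥-elim (¬s s)

  rkList-member : ∀ g {v} → v ∈ rkList g → ∃[ s ] v ≡ rk g s
  rkList-member g v∈ with T? (same g)
  rkList-member g (here refl) | yes s = s , refl

  rkList-unique : ∀ g → Unique (rkList g)
  rkList-unique g with T? (same g)
  ... | yes _ = All.[] ∷ []
  ... | no _ = []

  ∈-block : ∀ v → v ∈ block (blockOf v)
  ∈-block (pig i) = ∈-map⁺ pig (∈-allFin i)
  ∈-block (zv t) = ∈-map⁺ zv (∈-allFin t)
  ∈-block (ℓv g a) = ∈-concatMap-allFin⁺ g (∈-map⁺ (ℓv g) (∈-allFin a))
  ∈-block (ℓk g) = ∈-map⁺ ℓk (∈-allFin g)
  ∈-block (rv g a) = ∈-concatMap-allFin⁺ g (∈-map⁺ (rv g) (∈-allFin a))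
  ∈-block (rk g s) = ∈-concatMap-allFin⁺ g (rk∈rkList g s)

  block-member : ∀ b {v} → v ∈ block b → blockOf v ≡ b
  block-member 0F v∈ with ∈-map⁻ pig v∈
  ... | _ , _ , refl = refl
  block-member 1F v∈ with ∈-map⁻ zv v∈
  ... | _ , _ , refl = refl
  block-member 2F v∈ with ∈-concatMap-allFin⁻ v∈
  ... | g , v∈g with ∈-map⁻ (ℓv g) v∈g
  ...   | _ , _ , refl = refl
  block-member 3F v∈ with ∈-map⁻ ℓk v∈
  ... | _ , _ , refl = refl
  block-member 4F v∈ with ∈-concatMap-allFin⁻ v∈
  ... | g , v∈g with ∈-map⁻ (rv g) v∈g
  ...   | _ , _ , refl = refl
  block-member 5F v∈ with ∈-concatMap-allFin⁻ v∈
  ... | g , v∈g with rkList-member g v∈g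
  ...   | _ , refl = refl

  same-gadget : ∀ {A : Set} {f : Fin NG → A → Vtx} → (∀ {g h x y} → f g x ≡ f h y → g ≡ h) →
    ∀ {xs ys g h v} → v ∈ map (f g) xs → v ∈ map (f h) ys → g ≡ h
  same-gadget {f = f} f-injective {g = g} {h} v∈g v∈h with ∈-map⁻ (f g) v∈g | ∈-map⁻ (f h) v∈h
  ... | _ , _ , refl | _ , _ , eq = f-injective eq

  block-unique : ∀ b → Unique (block b)
  block-unique 0F = map-allFin⁺ λ { refl → refl }
  block-unique 1F = map-allFin⁺ λ { refl → refl }
  block-unique 2F = concatMap-allFin⁺ (λ g → map-allFin⁺ λ { refl → refl }) (same-gadget λ { refl → refl })
  block-unique 3F = map-allFin⁺ λ { refl → refl }
  block-unique 4F = concatMap-allFin⁺ (λ g → map-allFin⁺ λ { refl → refl }) (same-gadget λ { refl → refl })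
  block-unique 5F = concatMap-allFin⁺ rkList-unique λ {g} {h} v∈g v∈h →
    rk-gadget (rkList-member g v∈g) (rkList-member h v∈h)
    where
    rk-gadget : ∀ {g h v} → ∃[ s ] v ≡ rk g s → ∃[ s ] v ≡ rk h s → g ≡ h
    rk-gadget (_ , refl) (_ , refl) = refl

  vertexList-complete : ∀ v → v ∈ vertexList
  vertexList-complete v =
    subst (v ∈_) (sym vertexList-blocks) (∈-concatMap-allFin⁺ {f = block} (blockOf v) (∈-block v))

  vertexList-unique : Unique vertexList
  vertexList-unique = subst Unique (sym vertexList-blocks)
    (concatMap-allFin⁺ {f = block} block-unique λ {b} {b′} v∈b v∈b′ →
      trans (sym (block-member b v∈b)) (block-member b′ v∈b′))

  rkList-length-≤ : ∀ g → length (rkList g) ≤ 1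
  rkList-length-≤ g with T? (same g)
  ... | yes _ = ℕ.≤-refl
  ... | no _ = z≤n

  blockSize : Fin 6 → ℕ
  blockSize 0F = n
  blockSize 1F = M
  blockSize 2F = NG * (K ∸ 1)
  blockSize 3F = NG
  blockSize 4F = NG * (K ∸ 1)
  blockSize 5F = NG * 1

  block-length-≤ : ∀ b → length (block b) ≤ blockSize b
  block-length-≤ 0F = ℕ.≤-reflexive (length-map-allFin pig)
  block-length-≤ 1F = ℕ.≤-reflexive (length-map-allFin zv)
  block-length-≤ 2F = ℕ.≤-reflexive (trans (length-concatMap-allFin (λ g → map (ℓv g) (allFin (K ∸ 1))))
    (trans (sum-cong-≗ (length-map-allFin ∘ ℓv)) (∑-const NG _)))
  block-length-≤ 3F = ℕ.≤-reflexive (length-map-allFin ℓk)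
  block-length-≤ 4F = ℕ.≤-reflexive (trans (length-concatMap-allFin (λ g → map (rv g) (allFin (K ∸ 1))))
    (trans (sum-cong-≗ (length-map-allFin ∘ rv)) (∑-const NG _)))
  block-length-≤ 5F = ℕ.≤-trans (ℕ.≤-reflexive (length-concatMap-allFin rkList)) (∑-≤-* rkList-length-≤)

  numVertices-≤ : numVertices graph ≤ n + 4 * K * NG
  numVertices-≤ = begin
    length vertexList                        ≡⟨ cong length vertexList-blocks ⟩
    length (concatMap block (allFin 6))      ≡⟨ length-concatMap-allFin block ⟩
    ∑[ b < 6 ] length (block b)              ≤⟨ ∑-mono-≤ block-length-≤ ⟩
    ∑[ b < 6 ] blockSize b                   ≡⟨ block-sizes n (K ∸ 1) NG ⟩
    n + 4 * K * NG                           ∎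
    where
    open ℕ.≤-Reasoning
    block-sizes : ∀ n K1 NG → n + (2 * suc K1 * NG + (NG * K1 + (NG + (NG * K1 + (NG * 1 + 0))))) ≡ n + 4 * suc K1 * NG
    block-sizes = solve-∀

  module RightDegreeBound (regular : LeftRegular nbr) (D : ℕ) (rightDeg-≤ : ∀ j → rightDeg nbr j ≤ D * K) where

    B : ℕ
    B = K * (D * K)

    edges-into-≤ : ∀ j → ∑[ i < n ] ∑[ c < K ] ⟦ nbr i c ==F j ⟧ ≤ D * K
    edges-into-≤ j = begin
      ∑[ i < n ] ∑[ c < K ] ⟦ nbr i c ==F j ⟧ ≤⟨ ∑-mono-≤ edges-of ⟩
      ∑[ i < n ] ⟦ adjB nbr i j ⟧             ≡⟨ count-tabulate (λ i → adjB nbr i j) id ⟨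
      rightDeg nbr j                          ≤⟨ rightDeg-≤ j ⟩
      D * K                                   ∎
      where
      open ℕ.≤-Reasoning
      edges-of : ∀ i → ∑[ c < K ] ⟦ nbr i c ==F j ⟧ ≤ ⟦ adjB nbr i j ⟧
      edges-of i with any? (λ c → nbr i c ≟ j)
      ... | yes (c , hit) = ℕ.≤-trans
        (∑-⟦⟧-≤1 _ (λ c c′ h h′ → regular i (trans (==F⇒≡ {a = nbr i c} h) (sym (==F⇒≡ {a = nbr i c′} h′)))))
        (ℕ.≤-reflexive (sym (⟦⟧-true (any⁺ (λ c → nbr i c ==F j) (Any.map (λ { refl → ≡⇒==F hit }) (∈-allFin c))))))
      ... | no miss = ℕ.≤-trans (ℕ.≤-reflexive (∑-zero λ c → ⟦⟧-false (λ h → miss (c , ==F⇒≡ {a = nbr i c} h)))) z≤n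

    pairsK : List (Fin K × Fin K)
    pairsK = cartesianProduct (allFin K) (allFin K)

    count-pairsK : ∀ (P : Fin K × Fin K → Bool) → count P pairsK ≡ ∑[ c < K ] ∑[ c′ < K ] ⟦ P (c , c′) ⟧
    count-pairsK P =
      trans (count-cartesianProduct-allFin P (allFin K)) (sum-cong-≗ λ c → count-tabulate (λ c′ → P (c , c′)) id)

    collision : ∀ {i i' c c'} → T (isGadget (i , i' , c , c')) → nbr i c ≡ nbr i' c'
    collision {i} {i'} {c} {c'} = ==F⇒≡ {a = nbr i c} {nbr i' c'} ∘ proj₂ ∘ T-∧⁻ {not (i ==F i')}

    gadgets-from-≤ : ∀ i₀ → count (λ r → isGadget (i₀ , r)) (cartesianProduct (allFin n) pairsK) ≤ B
    gadgets-from-≤ i₀ = begin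
      count (λ r → isGadget (i₀ , r)) (cartesianProduct (allFin n) pairsK)
        ≡⟨ count-cartesianProduct-allFin (λ r → isGadget (i₀ , r)) pairsK ⟩
      ∑[ i' < n ] count (λ r → isGadget (i₀ , i' , r)) pairsK
        ≡⟨ sum-cong-≗ (λ i' → count-pairsK (λ r → isGadget (i₀ , i' , r))) ⟩
      ∑[ i' < n ] ∑[ c < K ] ∑[ c' < K ] ⟦ isGadget (i₀ , i' , c , c') ⟧
        ≤⟨ ∑-mono-≤ (λ i' → ∑-mono-≤ λ c → ∑-mono-≤ λ c' →
             ⟦⟧-mono {isGadget (i₀ , i' , c , c')} {nbr i' c' ==F nbr i₀ c} (≡⇒==F ∘ sym ∘ collision)) ⟩
      ∑[ i' < n ] ∑[ c < K ] ∑[ c' < K ] ⟦ nbr i' c' ==F nbr i₀ c ⟧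
        ≡⟨ ∑-comm (λ i' c → ∑[ c' < K ] ⟦ nbr i' c' ==F nbr i₀ c ⟧) ⟩
      ∑[ c < K ] ∑[ i' < n ] ∑[ c' < K ] ⟦ nbr i' c' ==F nbr i₀ c ⟧
        ≤⟨ ∑-≤-* (λ c → edges-into-≤ (nbr i₀ c)) ⟩
      B ∎
      where open ℕ.≤-Reasoning

    gadgets-into-≤ : ∀ i₀ → ∑[ i < n ] count (λ r → isGadget (i , i₀ , r)) pairsK ≤ B
    gadgets-into-≤ i₀ = begin
      ∑[ i < n ] count (λ r → isGadget (i , i₀ , r)) pairsK
        ≡⟨ sum-cong-≗ (λ i → count-pairsK (λ r → isGadget (i , i₀ , r))) ⟩
      ∑[ i < n ] ∑[ c < K ] ∑[ c' < K ] ⟦ isGadget (i , i₀ , c , c') ⟧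
        ≤⟨ ∑-mono-≤ (λ i → ∑-mono-≤ λ c → ∑-mono-≤ λ c' →
             ⟦⟧-mono {isGadget (i , i₀ , c , c')} {nbr i c ==F nbr i₀ c'} (≡⇒==F ∘ collision)) ⟩
      ∑[ i < n ] ∑[ c < K ] ∑[ c' < K ] ⟦ nbr i c ==F nbr i₀ c' ⟧
        ≡⟨ sum-cong-≗ (λ i → ∑-comm (λ c c' → ⟦ nbr i c ==F nbr i₀ c' ⟧)) ⟩
      ∑[ i < n ] ∑[ c' < K ] ∑[ c < K ] ⟦ nbr i c ==F nbr i₀ c' ⟧
        ≡⟨ ∑-comm (λ i c' → ∑[ c < K ] ⟦ nbr i c ==F nbr i₀ c' ⟧) ⟩
      ∑[ c' < K ] ∑[ i < n ] ∑[ c < K ] ⟦ nbr i c ==F nbr i₀ c' ⟧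
        ≤⟨ ∑-≤-* (λ c' → edges-into-≤ (nbr i₀ c')) ⟩
      B ∎
      where open ℕ.≤-Reasoning

    count-gadgets : ∀ (P : Quad → Bool) → ∑[ g < NG ] ⟦ P (gad g) ⟧ ≡ count (λ q → isGadget q ∧ P q) quads
    count-gadgets P = trans (sym (count-lookup P gadgets)) (count-filter P isGadget quads)

    gadgets-at-left-≤ : ∀ i₀ → ∑[ g < NG ] ⟦ gi g ==F i₀ ⟧ ≤ B
    gadgets-at-left-≤ i₀ = begin
      ∑[ g < NG ] ⟦ gi g ==F i₀ ⟧
        ≡⟨ count-gadgets (λ q → proj₁ q ==F i₀) ⟩
      count (λ q → isGadget q ∧ (proj₁ q ==F i₀)) quads
        ≡⟨ count-cartesianProduct-allFin (λ q → isGadget q ∧ (proj₁ q ==F i₀)) rest ⟩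
      ∑[ i < n ] count (λ r → isGadget (i , r) ∧ (i ==F i₀)) rest
        ≡⟨ sum-cong-≗ (λ i → count-∧ʳ (λ r → isGadget (i , r)) (i ==F i₀) rest) ⟩
      ∑[ i < n ] (⟦ i ==F i₀ ⟧ * count (λ r → isGadget (i , r)) rest)
        ≡⟨ ∑-pick i₀ (λ i → count (λ r → isGadget (i , r)) rest) ⟩
      count (λ r → isGadget (i₀ , r)) rest
        ≤⟨ gadgets-from-≤ i₀ ⟩
      B ∎
      where
      open ℕ.≤-Reasoning
      rest = cartesianProduct (allFin n) pairsK

    gadgets-at-right-≤ : ∀ i₀ → ∑[ g < NG ] ⟦ gi' g ==F i₀ ⟧ ≤ B
    gadgets-at-right-≤ i₀ = begin
      ∑[ g < NG ] ⟦ gi' g ==F i₀ ⟧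
        ≡⟨ count-gadgets (λ q → proj₁ (proj₂ q) ==F i₀) ⟩
      count (λ q → isGadget q ∧ (proj₁ (proj₂ q) ==F i₀)) quads
        ≡⟨ count-cartesianProduct-allFin (λ q → isGadget q ∧ (proj₁ (proj₂ q) ==F i₀)) _ ⟩
      ∑[ i < n ] count (λ r → isGadget (i , r) ∧ (proj₁ r ==F i₀)) (cartesianProduct (allFin n) pairsK)
        ≡⟨ sum-cong-≗ (λ i → count-cartesianProduct-allFin (λ r → isGadget (i , r) ∧ (proj₁ r ==F i₀)) pairsK) ⟩
      ∑[ i < n ] ∑[ i' < n ] count (λ r → isGadget (i , i' , r) ∧ (i' ==F i₀)) pairsK
        ≡⟨ sum-cong-≗ (λ i → sum-cong-≗ λ i' → count-∧ʳ (λ r → isGadget (i , i' , r)) (i' ==F i₀) pairsK) ⟩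
      ∑[ i < n ] ∑[ i' < n ] (⟦ i' ==F i₀ ⟧ * count (λ r → isGadget (i , i' , r)) pairsK)
        ≡⟨ sum-cong-≗ (λ i → ∑-pick i₀ (λ i' → count (λ r → isGadget (i , i' , r)) pairsK)) ⟩
      ∑[ i < n ] count (λ r → isGadget (i , i₀ , r)) pairsK
        ≤⟨ gadgets-into-≤ i₀ ⟩
      B ∎
      where open ℕ.≤-Reasoning

    NG-≤ : NG ≤ n * B
    NG-≤ = ℕ.≤-trans (ℕ.≤-reflexive (count-cartesianProduct-allFin isGadget (cartesianProduct (allFin n) pairsK)))
      (∑-≤-* gadgets-from-≤)

    U : ℕ
    U = B + 2 * K

    2K≤U : 2 * K ≤ U
    2K≤U = ℕ.m≤n+m (2 * K) B

    1≤U : 1 * 1 ≤ U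
    1≤U = ℕ.≤-trans (s≤s z≤n) 2K≤U

    K-1≤U : 1 * (K ∸ 1) ≤ U
    K-1≤U = ℕ.≤-trans (ℕ.≤-reflexive (ℕ.*-identityˡ (K ∸ 1)))
      (ℕ.≤-trans (ℕ.m∸n≤m K 1) (ℕ.≤-trans (ℕ.m≤m+n K (K + 0)) 2K≤U))

    B≤U : B * 1 ≤ U
    B≤U = ℕ.≤-trans (ℕ.≤-reflexive (ℕ.*-identityʳ B)) (ℕ.m≤m+n B (2 * K))

    no-neighbours : ∀ N → ∑[ i < N ] 0 ≤ U
    no-neighbours N = ℕ.≤-trans (ℕ.≤-reflexive (sum-replicate-zero N)) z≤n

    no-neighbours₂ : ∑[ g < NG ] ∑[ a < K ∸ 1 ] 0 ≤ U
    no-neighbours₂ =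
      ℕ.≤-trans (ℕ.≤-reflexive (∑-zero {NG} {λ g → ∑[ a < K ∸ 1 ] 0} λ g → sum-replicate-zero (K ∸ 1))) z≤n

    gadget-neighbours-≤ : ∀ {F : Fin NG → ℕ} (s : Fin NG → Bool) {h w} →
      (∀ g → F g ≤ ⟦ s g ⟧ * w) → ∑[ g < NG ] ⟦ s g ⟧ ≤ h → h * w ≤ U → sum F ≤ U
    gadget-neighbours-≤ s {h} {w} F≤ selected hw≤U =
      ℕ.≤-trans (∑-select s w F≤) (ℕ.≤-trans (ℕ.*-monoˡ-≤ w selected) hw≤U)

    one-gadget : ∀ g → ∑[ h < NG ] ⟦ h ==F g ⟧ ≤ 1
    one-gadget g = ∑-⟦⟧-≤1-at _ g (λ h e → ==F⇒≡ {a = h} e)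

    ==F-sym : ∀ {N} {a b : Fin N} → T (a ==F b) → T (b ==F a)
    ==F-sym {a = a} {b} e = ≡⇒==F (sym (==F⇒≡ {a = a} {b} e))

    first-of-clique : ∀ {x} (a : Fin (K ∸ 1)) → T (x ∧ (toℕ a == 0)) → a ≡ zero
    first-of-clique zero _ = refl
    first-of-clique {x} (suc a) e = ⊥-elim (proj₂ (T-∧⁻ {x} e))

    pigeon-neighbours-≤ : ∀ v → ∑[ i < n ] ⟦ adjG v (pig i) ⟧ ≤ U
    pigeon-neighbours-≤ (pig _) = no-neighbours n
    pigeon-neighbours-≤ (zv _) = no-neighbours n
    pigeon-neighbours-≤ (ℓv g a) = ℕ.≤-trans (∑-⟦⟧-≤1-at (λ i → adjG (ℓv g a) (pig i)) (gi g)
      λ i e → ==F⇒≡ {a = i} (proj₁ (T-∧⁻ {i ==F gi g} e))) 1≤U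
    pigeon-neighbours-≤ (ℓk _) = no-neighbours n
    pigeon-neighbours-≤ (rv g a) = ℕ.≤-trans (∑-⟦⟧-≤1-at (λ i → adjG (rv g a) (pig i)) (gi' g)
      λ i e → ==F⇒≡ {a = i} (proj₁ (T-∧⁻ {i ==F gi' g} e))) 1≤U
    pigeon-neighbours-≤ (rk _ _) = no-neighbours n

    z-neighbours-≤ : ∀ v → ∑[ u < M ] ⟦ adjG v (zv u) ⟧ ≤ U
    z-neighbours-≤ (pig _) = no-neighbours M
    z-neighbours-≤ (zv t) = ℕ.≤-trans (∑-mono-≤ λ u → ⟦⟧-mono {adjG (zv t) (zv u)} (close-window u))
      (ℕ.≤-trans (∑-inInterval-≤ M (toℕ t ∸ K) (2 * K)) 2K≤U)
      where
      close-sym : ∀ {a b} → T (close K a b) → T (close K b a)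
      close-sym {a} {b} c = T-∧⁺ (proj₂ (T-∧⁻ {a ∸ b <ᵇ K} c)) (proj₁ (T-∧⁻ {a ∸ b <ᵇ K} c))
      close-of-edge : ∀ {t u} → T (E (zv t) (zv u)) → T (close K (toℕ t) (toℕ u))
      close-of-edge {t} {u} e = proj₁ (T-∧⁻ {close K (toℕ t) (toℕ u)} (proj₂ (T-∧⁻ {not (t ==F u)} e)))
      close-window : ∀ u → T (adjG (zv t) (zv u)) → T (inInterval (toℕ t ∸ K) (2 * K) (toℕ u))
      close-window u e = close⇒inInterval K (toℕ t) (toℕ u)
        ([ close-of-edge {t} {u} , close-sym {toℕ u} ∘ close-of-edge {u} {t} ] (T-∨⁻ {E (zv t) (zv u)} e))
    z-neighbours-≤ (ℓv g a) = ℕ.≤-trans (∑-⟦⟧-≤1 (λ u → adjG (ℓv g a) (zv u)) λ u u′ e e′ → toℕ-injective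
      (trans (==⇒≡ {toℕ u} (proj₁ (T-∧⁻ {toℕ u == slotL g} e))) (sym (==⇒≡ {toℕ u′} (proj₁ (T-∧⁻ {toℕ u′ == slotL g} e′)))))) 1≤U
    z-neighbours-≤ (ℓk _) = no-neighbours M
    z-neighbours-≤ (rv g a) = ℕ.≤-trans (∑-⟦⟧-≤1 (λ u → adjG (rv g a) (zv u)) λ u u′ e e′ → toℕ-injective
      (trans (==⇒≡ {toℕ u} (proj₁ (T-∧⁻ {toℕ u == slotR g} e))) (sym (==⇒≡ {toℕ u′} (proj₁ (T-∧⁻ {toℕ u′ == slotR g} e′)))))) 1≤U
    z-neighbours-≤ (rk _ _) = no-neighbours M

    pig-ℓ-edge : ∀ i g a → T (adjG (pig i) (ℓv g a)) → gi g ≡ i × a ≡ zero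
    pig-ℓ-edge i g a e with T-∨-falseʳ {(i ==F gi g) ∧ (toℕ a == 0)} e
    ... | e′ = sym (==F⇒≡ {a = i} (proj₁ (T-∧⁻ {i ==F gi g} e′))) , first-of-clique a e′

    pig-r-edge : ∀ i g a → T (adjG (pig i) (rv g a)) → gi' g ≡ i × a ≡ zero
    pig-r-edge i g a e with T-∨-falseʳ {(i ==F gi' g) ∧ (toℕ a == 0)} e
    ... | e′ = sym (==F⇒≡ {a = i} (proj₁ (T-∧⁻ {i ==F gi' g} e′))) , first-of-clique a e′

    clique-edge : ∀ {g h : Fin NG} {x y} → T (((h ==F g) ∧ x) ∨ ((g ==F h) ∧ y)) → T (g ==F h)
    clique-edge {g} {h} {x} =
      [ ==F-sym {a = h} ∘ proj₁ ∘ T-∧⁻ {h ==F g} , proj₁ ∘ T-∧⁻ {g ==F h} ] ∘ T-∨⁻ {(h ==F g) ∧ x}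

    one-slotL : ∀ t → ∑[ g < NG ] ⟦ t == slotL g ⟧ ≤ 1
    one-slotL t = ∑-⟦⟧-≤1 _ λ g h e e′ → slotL-injective (trans (sym (==⇒≡ {t} e)) (==⇒≡ {t} e′))

    one-slotR : ∀ t → ∑[ g < NG ] ⟦ t == slotR g ⟧ ≤ 1
    one-slotR t = ∑-⟦⟧-≤1 _ λ g h e e′ → slotR-injective (trans (sym (==⇒≡ {t} e)) (==⇒≡ {t} e′))

    ℓ-neighbours-≤ : ∀ v → ∑[ g < NG ] ∑[ a < K ∸ 1 ] ⟦ adjG v (ℓv g a) ⟧ ≤ U
    ℓ-neighbours-≤ (pig i) = gadget-neighbours-≤ (λ g → gi g ==F i)
      (λ g → ∑-⟦⟧-≤-guard₁ (λ a → adjG (pig i) (ℓv g a)) (λ a → ≡⇒==F ∘ proj₁ ∘ pig-ℓ-edge i g a)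
        λ a a′ e e′ → trans (proj₂ (pig-ℓ-edge i g a e)) (sym (proj₂ (pig-ℓ-edge i g a′ e′))))
      (gadgets-at-left-≤ i) B≤U
    ℓ-neighbours-≤ (zv t) = gadget-neighbours-≤ (λ g → toℕ t == slotL g)
      (λ g → ∑-⟦⟧-≤-guard (λ a → adjG (zv t) (ℓv g a))
        λ a e → proj₁ (T-∧⁻ {toℕ t == slotL g} (T-∨-falseʳ {(toℕ t == slotL g) ∧ (1 ≤ᵇ toℕ a)} e)))
      (one-slotL (toℕ t)) K-1≤U
    ℓ-neighbours-≤ (ℓv h b) = gadget-neighbours-≤ (λ g → g ==F h)
      (λ g → ∑-⟦⟧-≤-guard (λ a → adjG (ℓv h b) (ℓv g a)) λ a → clique-edge {g} {h} {not (b ==F a)} {not (a ==F b)})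
      (one-gadget h) K-1≤U
    ℓ-neighbours-≤ (ℓk h) = gadget-neighbours-≤ (λ g → g ==F h)
      (λ g → ∑-⟦⟧-≤-guard (λ a → adjG (ℓk h) (ℓv g a)) λ a e → e)
      (one-gadget h) K-1≤U
    ℓ-neighbours-≤ (rv _ _) = no-neighbours₂
    ℓ-neighbours-≤ (rk _ _) = no-neighbours₂

    ℓk-neighbours-≤ : ∀ v → ∑[ g < NG ] ⟦ adjG v (ℓk g) ⟧ ≤ U
    ℓk-neighbours-≤ (pig _) = no-neighbours NG
    ℓk-neighbours-≤ (zv _) = no-neighbours NG
    ℓk-neighbours-≤ (ℓv h b) = ℕ.≤-trans (∑-⟦⟧-≤1-at (λ g → adjG (ℓv h b) (ℓk g)) h
      λ g e → sym (==F⇒≡ {a = h} (T-∨-falseʳ {h ==F g} e))) 1≤U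
    ℓk-neighbours-≤ (ℓk _) = no-neighbours NG
    ℓk-neighbours-≤ (rv h b) = ℕ.≤-trans (∑-⟦⟧-≤1-at (λ g → adjG (rv h b) (ℓk g)) h
      λ g e → sym (==F⇒≡ {a = h} (proj₁ (T-∧⁻ {h ==F g} (T-∨-falseʳ {(h ==F g) ∧ not (same g)} e))))) 1≤U
    ℓk-neighbours-≤ (rk h s) = ℕ.≤-trans (∑-⟦⟧-≤1-at (λ g → adjG (rk h s) (ℓk g)) h λ g → ==F⇒≡ {a = g}) 1≤U

    r-neighbours-≤ : ∀ v → ∑[ g < NG ] ∑[ a < K ∸ 1 ] ⟦ adjG v (rv g a) ⟧ ≤ U
    r-neighbours-≤ (pig i) = gadget-neighbours-≤ (λ g → gi' g ==F i)
      (λ g → ∑-⟦⟧-≤-guard₁ (λ a → adjG (pig i) (rv g a)) (λ a → ≡⇒==F ∘ proj₁ ∘ pig-r-edge i g a)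
        λ a a′ e e′ → trans (proj₂ (pig-r-edge i g a e)) (sym (proj₂ (pig-r-edge i g a′ e′))))
      (gadgets-at-right-≤ i) B≤U
    r-neighbours-≤ (zv t) = gadget-neighbours-≤ (λ g → toℕ t == slotR g)
      (λ g → ∑-⟦⟧-≤-guard (λ a → adjG (zv t) (rv g a))
        λ a e → proj₁ (T-∧⁻ {toℕ t == slotR g} (T-∨-falseʳ {(toℕ t == slotR g) ∧ (1 ≤ᵇ toℕ a)} e)))
      (one-slotR (toℕ t)) K-1≤U
    r-neighbours-≤ (ℓv _ _) = no-neighbours₂
    r-neighbours-≤ (ℓk h) = gadget-neighbours-≤ (λ g → g ==F h)
      (λ g → ∑-⟦⟧-≤-guard (λ a → adjG (ℓk h) (rv g a)) λ a → proj₁ ∘ T-∧⁻ {g ==F h})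
      (one-gadget h) K-1≤U
    r-neighbours-≤ (rv h b) = gadget-neighbours-≤ (λ g → g ==F h)
      (λ g → ∑-⟦⟧-≤-guard (λ a → adjG (rv h b) (rv g a)) λ a → clique-edge {g} {h} {not (b ==F a)} {not (a ==F b)})
      (one-gadget h) K-1≤U
    r-neighbours-≤ (rk h s) = gadget-neighbours-≤ (λ g → g ==F h)
      (λ g → ∑-⟦⟧-≤-guard (λ a → adjG (rk h s) (rv g a)) λ a e → e)
      (one-gadget h) K-1≤U

    count-rkList-≤ : ∀ (p : Vtx → Bool) g {b} → (∀ s → T (p (rk g s)) → T b) → count p (rkList g) ≤ ⟦ b ⟧
    count-rkList-≤ p g guard with T? (same g)
    ... | yes s = ℕ.≤-trans (ℕ.≤-reflexive (trans (count-∷ p (rk g s) []) (ℕ.+-identityʳ _))) (⟦⟧-mono (guard s))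
    ... | no _ = z≤n

    no-rk-neighbours : ∀ v → (∀ g s → ¬ T (adjG v (rk g s))) → ∑[ g < NG ] count (adjG v) (rkList g) ≤ U
    no-rk-neighbours v none = ℕ.≤-trans (∑-mono-≤ λ g → count-rkList-≤ (adjG v) g {false} (none g)) (no-neighbours NG)

    rk-neighbours-≤ : ∀ v → ∑[ g < NG ] count (adjG v) (rkList g) ≤ U
    rk-neighbours-≤ (pig i) = no-rk-neighbours (pig i) λ _ _ ()
    rk-neighbours-≤ (zv t) = no-rk-neighbours (zv t) λ _ _ ()
    rk-neighbours-≤ (ℓv h b) = no-rk-neighbours (ℓv h b) λ _ _ ()
    rk-neighbours-≤ (ℓk h) = ℕ.≤-trans (∑-mono-≤ λ g → count-rkList-≤ (adjG (ℓk h)) g {g ==F h}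
      λ s e → ==F-sym {a = h} (T-∨-falseʳ {h ==F g} e)) (ℕ.≤-trans (one-gadget h) 1≤U)
    rk-neighbours-≤ (rv h b) = ℕ.≤-trans (∑-mono-≤ λ g → count-rkList-≤ (adjG (rv h b)) g {g ==F h}
      λ s e → ==F-sym {a = h} (T-∨-falseʳ {h ==F g} e)) (ℕ.≤-trans (one-gadget h) 1≤U)
    rk-neighbours-≤ (rk h s) = no-rk-neighbours (rk h s) λ _ _ ()

    block-neighbours-≤ : ∀ b v → count (adjG v) (block b) ≤ U
    block-neighbours-≤ 0F v = ℕ.≤-trans (ℕ.≤-reflexive (count-map-allFin (adjG v) pig)) (pigeon-neighbours-≤ v)
    block-neighbours-≤ 1F v = ℕ.≤-trans (ℕ.≤-reflexive (count-map-allFin (adjG v) zv)) (z-neighbours-≤ v)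
    block-neighbours-≤ 2F v = ℕ.≤-trans
      (ℕ.≤-reflexive (trans (count-concatMap-allFin (adjG v) (λ g → map (ℓv g) (allFin (K ∸ 1))))
      (sum-cong-≗ λ g → count-map-allFin (adjG v) (ℓv g)))) (ℓ-neighbours-≤ v)
    block-neighbours-≤ 3F v = ℕ.≤-trans (ℕ.≤-reflexive (count-map-allFin (adjG v) ℓk)) (ℓk-neighbours-≤ v)
    block-neighbours-≤ 4F v = ℕ.≤-trans
      (ℕ.≤-reflexive (trans (count-concatMap-allFin (adjG v) (λ g → map (rv g) (allFin (K ∸ 1))))
      (sum-cong-≗ λ g → count-map-allFin (adjG v) (rv g)))) (r-neighbours-≤ v)
    block-neighbours-≤ 5F v = ℕ.≤-trans (ℕ.≤-reflexive (count-concatMap-allFin (adjG v) rkList)) (rk-neighbours-≤ v)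

    degree-≤ : ∀ v → degree graph v ≤ 6 * U
    degree-≤ v = begin
      count (adjG v) vertexList                   ≡⟨ cong (count (adjG v)) vertexList-blocks ⟩
      count (adjG v) (concatMap block (allFin 6)) ≡⟨ count-concatMap-allFin (adjG v) block ⟩
      ∑[ b < 6 ] count (adjG v) (block b)         ≤⟨ ∑-≤-* (λ b → block-neighbours-≤ b v) ⟩
      6 * U                                       ∎
      where open ℕ.≤-Reasoning

open import Data.Integer using (+_; -[1+_]; ∣_∣)
import Data.Integer as ℤ
import Data.Integer.Properties as ℤ
open import Data.Rational using (ℚ; 0ℚ; _/_; mkℚ; ↥_) renaming (_<_ to _<ℚ_; _≤_ to _≤ℚ_; _*_ to _*ℚ_)
import Data.Rational.Properties as ℚ
open import Data.Rational.Unnormalised using (mkℚᵘ)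
import Data.Rational.Unnormalised as ℚᵘ
import Data.Rational.Unnormalised.Properties as ℚᵘ

i≤+∣i∣ : ∀ i → i ℤ.≤ + ∣ i ∣
i≤+∣i∣ (+ n) = ℤ.≤-refl
i≤+∣i∣ -[1+ n ] = ℤ.-≤+

-- The denominator of C is positive, so C ≤ ∣ ↥ C ∣.
ℕ-bound-from-ℚ : ∀ C d k → (+ d / 1) ≤ℚ (C *ℚ (+ k / 1)) → d ≤ ∣ ↥ C ∣ * k
ℕ-bound-from-ℚ C@(mkℚ num den-1 _) d k d≤Ck = cross-multiplied toℚᵘ-bound
  where
  toℚᵘ-bound : mkℚᵘ (+ d) 0 ℚᵘ.≤ mkℚᵘ num den-1 ℚᵘ.* mkℚᵘ (+ k) 0
  toℚᵘ-bound = ℚᵘ.≤-respˡ-≃ (ℚ.toℚᵘ-fromℚᵘ (mkℚᵘ (+ d) 0))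
    (ℚᵘ.≤-respʳ-≃ (ℚᵘ.≃-trans (ℚ.toℚᵘ-homo-* C (+ k / 1))
                                (ℚᵘ.*-congˡ {mkℚᵘ num den-1} (ℚ.toℚᵘ-fromℚᵘ (mkℚᵘ (+ k) 0))))
      (ℚ.toℚᵘ-mono-≤ d≤Ck))
  cross-multiplied : mkℚᵘ (+ d) 0 ℚᵘ.≤ mkℚᵘ num den-1 ℚᵘ.* mkℚᵘ (+ k) 0 → d ≤ ∣ num ∣ * k
  cross-multiplied (ℚᵘ.*≤* d*den≤num*k) = ℤ.drop‿+≤+ (ℤ.≤-trans d≤d*den (ℤ.≤-trans d*den≤num*k num*k≤∣num∣*k))
    where
    d≤d*den : + d ℤ.≤ + d ℤ.* + (suc den-1 * 1)
    d≤d*den = subst (+ d ℤ.≤_) (ℤ.pos-* d (suc den-1 * 1))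
      (ℤ.+≤+ (ℕ.m≤m*n d (suc den-1 * 1) {{ℕ.m*n≢0 (suc den-1) 1}}))
    num*k≤∣num∣*k : (num ℤ.* + k) ℤ.* + 1 ℤ.≤ + (∣ num ∣ * k)
    num*k≤∣num∣*k = subst₂ ℤ._≤_ (sym (ℤ.*-identityʳ (num ℤ.* + k))) (sym (ℤ.pos-* ∣ num ∣ k))
      (ℤ.*-monoʳ-≤-nonNeg (+ k) (i≤+∣i∣ num))

size-arithmetic : ∀ K′ D n NG → let K = suc K′ in
  NG ≤ n * (K * (D * K)) → n + 4 * K * NG ≤ (1 + 4 * D) * K ^ 4 * n
size-arithmetic K′ D n NG NG≤ = begin
  n + 4 * K * NG                      ≤⟨ ℕ.+-monoʳ-≤ n (ℕ.*-monoʳ-≤ (4 * K) NG≤) ⟩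
  n + 4 * K * (n * (K * (D * K)))     ≡⟨ regroup n K D ⟩
  1 * n + 4 * D * (K ^ 3 * n)         ≤⟨ ℕ.+-mono-≤ (ℕ.*-monoˡ-≤ n (ℕ.m^n>0 K 4))
                                                     (ℕ.*-monoʳ-≤ (4 * D) (ℕ.*-monoˡ-≤ n (ℕ.m≤n*m (K ^ 3) K))) ⟩
  K ^ 4 * n + 4 * D * (K ^ 4 * n)     ≡⟨ factor n K D ⟩
  (1 + 4 * D) * K ^ 4 * n             ∎
  where
  open ℕ.≤-Reasoning
  K = suc K′
  regroup : ∀ n x d → n + 4 * x * (n * (x * (d * x))) ≡ 1 * n + 4 * d * (x * (x * (x * 1)) * n)
  regroup = solve-∀
  factor : ∀ n x d → let x⁴ = x * (x * (x * (x * 1))) in x⁴ * n + 4 * d * (x⁴ * n) ≡ (1 + 4 * d) * x⁴ * n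
  factor = solve-∀

degree-arithmetic : ∀ K′ D → let K = suc K′ in 6 * (K * (D * K) + 2 * K) ≤ 6 * (D + 2) * K ^ 2
degree-arithmetic K′ D = begin
  6 * (K * (D * K) + 2 * K)            ≡⟨ expand K D ⟩
  6 * D * K ^ 2 + 12 * K               ≤⟨ ℕ.+-monoʳ-≤ (6 * D * K ^ 2) (ℕ.*-monoʳ-≤ 12 (ℕ.m≤m*n K (K * 1))) ⟩
  6 * D * K ^ 2 + 12 * K ^ 2           ≡⟨ factor K D ⟩
  6 * (D + 2) * K ^ 2                  ∎
  where
  open ℕ.≤-Reasoning
  K = suc K′
  expand : ∀ x d → 6 * (x * (d * x) + 2 * x) ≡ 6 * d * (x * (x * 1)) + 12 * x
  expand = solve-∀
  factor : ∀ x d → 6 * d * (x * (x * 1)) + 12 * (x * (x * 1)) ≡ 6 * (d + 2) * (x * (x * 1))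
  factor = solve-∀

proposition3p4 : (C : ℚ) → 0ℚ <ℚ C →
    ∃[ D₁ ] ∃[ D₂ ]
      ((k n m : ℕ) → 3 ≤ k → (nbr : Fin n → Fin k → Fin m) →
        LeftRegular nbr →
        (∀ j → (+ rightDeg nbr j / 1) ≤ℚ (C *ℚ (+ k / 1))) →
        (∀ v → v ∈ vertices (GB k n m nbr))
        × Unique (vertices (GB k n m nbr))
        × numVertices (GB k n m nbr) ≤ D₁ * k ^ 4 * n
        × (∀ v → degree (GB k n m nbr) v ≤ D₂ * k ^ 2)
        × (Colourable k (GB k n m nbr) ⇔ PigeonMap nbr)
        × (Colourable k (GB k n m nbr) ⇔ FPHPSatisfiable nbr))
proposition3p4 C _ = 1 + 4 * D , 6 * (D + 2) , λ where
    (suc (suc (suc k₀))) n m (s≤s (s≤s (s≤s z≤n))) nbr regular rightDeg-bound →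
      let open Graph k₀ n m nbr
          open RightDegreeBound regular D (λ j → ℕ-bound-from-ℚ C (rightDeg nbr j) K (rightDeg-bound j))
      in vertexList-complete , vertexList-unique ,
         ℕ.≤-trans numVertices-≤ (size-arithmetic (suc (suc k₀)) D n NG NG-≤) ,
         (λ v → ℕ.≤-trans (degree-≤ v) (degree-arithmetic (suc (suc k₀)) D)) ,
         colourable⇔pigeonMap , pigeonMap⇔fphp regular ⇔-∘ colourable⇔pigeonMap
  where
  D : ℕ
  D = ∣ ↥ C ∣
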